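{- For any non-empty admissible index $\boldsymbol{k}=(k_1, \ldots, k_r)$, \begin{align*} \sum_{m=0}^{\infty}u^{m}\sum_{\substack{\mathrm{wt}(\boldsymbol{e})=m\\\mathrm{dep}(\boldsymbol{e})=\mathrm{dep}(\boldsymbol{k}^{\dagger})}} I^{t}\bigl((\boldsymbol{k}^{\dagger}\oplus\boldsymbol{e})^{\dagger}\bigr) &= \tau\sigma\tau(X(\boldsymbol{k})), \end{align*} where $\boldsymbol{e}$ runs over tuples of non-negative integers.
   Context: Indices are tuples of positive integers; $\mathrm{wt}$ = sum of entries, $\mathrm{dep}$ = number of entries, $\oplus$ componentwise addition; $(k_1,\dots,k_r)$ is admissible if $k_r\ge2$. For admissible $\boldsymbol{k}=(\{1\}^{a_1-1}, b_1+1, \ldots, \{1\}^{a_s-1}, b_s+1)$ ($a_p,b_q\ge1$), the dual is $\boldsymbol{k}^{\dagger}=(\{1\}^{b_s-1}, a_s+1, \ldots, \{1\}^{b_1-1}, a_1+1)$. $I^t$ is the $\mathbb{Q}[t]$-linear map on formal combinations of indices with $I^t(k_1,\dots,k_r)=\sum t^{(\text{number of `+'})}(k_1\square\cdots\square k_r)$ over all choices of each $\square$ as a comma or a plus. Indices are identified with words in the non-commutative ring $\mathbb{Q}\langle x,y\rangle$ via $(k_1,\dots,k_r)\leftrightarrow yx^{k_1-1}\cdots yx^{k_r-1}$. $\sigma$ is the automorphism of $\mathbb{Q}\langle x,y\rangle[[t,u]]$ with $\sigma(x)=x$, $\sigma(y)=y(1-xu)^{ -1}$; $\tau$ is the anti-automorphism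 of $\mathbb{Q}\langle x,y\rangle$ interchanging $x$ and $y$, extended coefficientwise to $\mathbb{Q}\langle x,y\rangle[[t,u]]$. Binomial coefficients with integer (possibly negative) top are $\binom{n}{j}=n(n-1)\cdots(n-j+1)/j!$. Finally $X(\boldsymbol{k})=\sum_{l=1}^{r}\sum_{e_1,\dots,e_l\ge0}t^{r-l}(tu)^{e_1+\cdots+e_l}\sum_{\boldsymbol{k}=(\boldsymbol{k}_1,\dots,\boldsymbol{k}_l),\ \mathrm{dep}(\boldsymbol{k}_i)>0}\prod_{l'=1}^{l}\binom{\mathrm{wt}(\boldsymbol{k}_{l'})-\mathrm{dep}(\boldsymbol{k}_{l'})+e_{l'}+\delta_{l',1}-2}{e_{l'}}\times yx^{\mathrm{wt}(\boldsymbol{k}_1)+e_1-1}\cdots yx^{\mathrm{wt}(\boldsymbol{k}_l)+e_l-1}$ (sum over decompositions into consecutive non-empty blocks), which equals $y(\frac{x}{1-xtu})^{k_1-1}\prod_{l=2}^r\{(y(1-xtu)+xt)(\frac{x}{1-xtu})^{k_l-1}\}$. -}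

module Defs where

open import Data.Nat as ℕ using (ℕ; zero; suc; _∸_; _≤_)
open import Data.Integer as ℤ using (ℤ)
open import Data.Rational as ℚ using (ℚ; 0ℚ; 1ℚ)
open import Data.List using (List; []; _∷_; [_]; _++_; map; concatMap; replicate; reverse; zipWith; length; upTo; foldr)
open import Data.Product using (_×_; _,_; ∃₂)
open import Data.Bool using (Bool; true; false; if_then_else_; _∧_)
open import Relation.Nullary.Decidable using (does)
open import Relation.Binary.PropositionalEquality using (_≡_; refl)
open import Relation.Nullary using (Dec; yes; no)
import Data.List.Properties as LP
open import Data.Nat.ListAction using (sum)

data Letter : Set where
  𝕩 𝕪 : Letter

_≟L_ : (a b : Letter) → Dec (a ≡ b)
𝕩 ≟L 𝕩 = yes refl
𝕩 ≟L 𝕪 = no (λ ())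
𝕪 ≟L 𝕩 = no (λ ())
𝕪 ≟L 𝕪 = yes refl

Word : Set
Word = List Letter

_≟W_ : (v w : Word) → Dec (v ≡ w)
_≟W_ = LP.≡-dec _≟L_

Index : Set
Index = List ℕ

wt : Index → ℕ
wt = sum

dep : Index → ℕ
dep = length

Admissible : Index → Set
Admissible k = ∃₂ λ ks kr → (k ≡ ks ++ [ kr ]) × (2 ≤ kr)

idxWord : Index → Word
idxWord = concatMap (λ k → 𝕪 ∷ replicate (k ∸ 1) 𝕩)

-- decomposition k = ({1}^{a₁-1}, b₁+1, …, {1}^{a_s-1}, b_s+1) ↦ [(a₁,b₁),…,(a_s,b_s)]
-- (c counts the 1's seen so far in the current block)
abPairs : ℕ → Index → List (ℕ × ℕ)
abPairs c [] = []
abPairs c (suc zero ∷ ks) = abPairs (suc c) ks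
abPairs c (k ∷ ks) = (suc c , k ∸ 1) ∷ abPairs 0 ks

-- k† = ({1}^{b_s-1}, a_s+1, …, {1}^{b₁-1}, a₁+1)
dual : Index → Index
dual k = concatMap (λ { (a , b) → replicate (b ∸ 1) 1 ++ [ suc a ] }) (reverse (abPairs 0 k))

_⊕_ : Index → List ℕ → Index
_⊕_ = zipWith ℕ._+_

comps : ℕ → ℕ → List (List ℕ)
comps zero    zero    = [ [] ]
comps (suc m) zero    = []
comps m       (suc d) = concatMap (λ i → map (i ∷_) (comps (m ∸ i) d)) (upTo (suc m))

-- Elements of Q<x,y>[t] : finite formal sums  Σ c · t^n · w
-- Elements of Q<x,y>[t][[u]] ⊆ Q<x,y>[[t,u]] : sequences of u-coefficients

Poly : Set
Poly = List (ℚ × ℕ × Word)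

Series : Set
Series = ℕ → Poly

coeff : Poly → ℕ → Word → ℚ
coeff P n w = foldr (λ { (c , n' , w') acc →
                 if does (n ℕ.≟ n') ∧ does (w ≟W w') then c ℚ.+ acc else acc }) 0ℚ P

-- I^t : sum over comma/plus choices, weighted by t^{#plus}
-- (returns list of (exponent of t, resulting index), each with coefficient 1)

Igo : ℕ → Index → List (ℕ × Index)
Igo a [] = [ (0 , [ a ]) ]
Igo a (b ∷ bs) = map (λ { (n , i) → (n , a ∷ i) }) (Igo b bs)
              ++ map (λ { (n , i) → (suc n , i) }) (Igo (a ℕ.+ b) bs)

Iterms : Index → List (ℕ × Index)
Iterms [] = [ (0 , []) ]
Iterms (k ∷ ks) = Igo k ks

It : Index → Poly
It k = map (λ { (n , i) → (1ℚ , n , idxWord i) }) (Iterms k)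

LHS : Index → Series
LHS k m = concatMap (λ e → It (dual (dual k ⊕ e))) (comps m (dep (dual k)))

binomℤ : ℤ → ℕ → ℚ
binomℤ n zero    = 1ℚ
binomℤ n (suc j) = binomℤ n j ℚ.* ((n ℤ.- ℤ.+ j) ℚ./ suc j)

-- decompositions of an index into consecutive non-empty blocks
addFront : ℕ → List Index → List (List Index)
addFront k [] = [ [ [ k ] ] ]
addFront k (b ∷ bs) = ([ k ] ∷ b ∷ bs) ∷ ((k ∷ b) ∷ bs) ∷ []

splits : Index → List (List Index)
splits [] = [ [] ]
splits (k ∷ ks) = concatMap (addFront k) (splits ks)

δ : Bool → ℤ
δ true  = ℤ.+ 1
δ false = ℤ.+ 0

Xcoef : Bool → List Index → List ℕ → ℚ
Xcoef first (b ∷ bs) (e ∷ es) =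
  binomℤ (ℤ.+ wt b ℤ.- ℤ.+ dep b ℤ.+ ℤ.+ e ℤ.+ δ first ℤ.- ℤ.+ 2) e ℚ.* Xcoef false bs es
Xcoef first _ _ = 1ℚ

Xword : List Index → List ℕ → Word
Xword (b ∷ bs) (e ∷ es) = 𝕪 ∷ replicate (wt b ℕ.+ e ∸ 1) 𝕩 ++ Xword bs es
Xword _ _ = []

X : Index → Series
X k m = concatMap (λ B → map (λ e → (Xcoef true B e , dep k ∸ length B ℕ.+ m , Xword B e))
                             (comps m (length B)))
                  (splits k)

swapL : Letter → Letter
swapL 𝕩 = 𝕪
swapL 𝕪 = 𝕩

τw : Word → Word
τw w = reverse (map swapL w)

τ : Series → Series
τ F m = map (λ { (c , n , w) → (c , n , τw w) }) (F m)

-- σ : automorphism x ↦ x, y ↦ y(1-xu)^{-1} = Σ_i y x^i u^i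
-- σw j w = words occurring (with coefficient 1 each) in the u^j coefficient of σ(w)
σw : ℕ → Word → List Word
σw zero    [] = [ [] ]
σw (suc j) [] = []
σw j (𝕩 ∷ w) = map (𝕩 ∷_) (σw j w)
σw j (𝕪 ∷ w) = concatMap (λ i → map (λ v → 𝕪 ∷ replicate i 𝕩 ++ v) (σw (j ∸ i) w)) (upTo (suc j))

σ : Series → Series
σ F M = concatMap (λ m → concatMap (λ { (c , n , w) → map (λ v → (c , n , v)) (σw (M ∸ m) w) }) (F m))
                  (upTo (suc M))

-- Write word(k) = y v with v = x^(k₁−1) word(k′).
-- Left-hand side: the word of k† is the reverse of word(k) with x and y swapped (τ), and the words of
-- k† ⊕ e for all e of weight m make up the u^m part of σ(word(k†)).  Since I^t keeps the first y and
-- sends every later y to y + t x (the homomorphism Φ), the left-hand side is y · Φ(τστ(v)).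
-- The key identity is Φ ∘ τστ = τστ ∘ ρ on words, where ρ is the substitution x ↦ x′ = x(1 − xtu)⁻¹,
-- y ↦ y′ = y(1 − xtu) + xt; it is proved letter by letter, and for y the term −ytxu of y′ cancels
-- against the shift in u that τστ produces (τστ fixes y and sends x to (1 − yu)⁻¹x).
-- Right-hand side: X(k) = y ρ(v).  Peeling off the first block of a decomposition of k, the binomial
-- coefficients of X recombine by Pascal's rule into powers of x′, which gives the product formula.
module Submission where

open import Defs
open import Level using (0ℓ)
open import Function using (_∘_)
open import Data.Bool using (true; false; if_then_else_; _∧_)
open import Data.Empty using (⊥-elim)
open import Data.Product using (_×_; _,_; proj₁; proj₂; Σ)
import Data.Product.Properties as PP
open import Data.Nat as ℕ using (ℕ; zero; suc; _∸_; _≤_; _<_; s≤s; z≤n; _+_)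
import Data.Nat.Properties as NP
import Data.Nat.Tactic.RingSolver as NS
open import Data.Integer as ℤ using (ℤ; +_; -[1+_]; -1ℤ)
import Data.Integer.Properties as ZP
import Data.Integer.Tactic.RingSolver as ZS
open import Data.Rational as ℚ using (ℚ; 0ℚ; 1ℚ)
import Data.Rational.Properties as QP
open import Data.Rational.Solver using (module +-*-Solver)
open import Data.Rational.Unnormalised as ℚᵘ using (mkℚᵘ; *≡*)
import Data.Rational.Unnormalised.Properties as UP
open import Data.List using (List; []; _∷_; [_]; _++_; map; concatMap; replicate; reverse; length; upTo; applyUpTo; deduplicate)
import Data.List.Properties as LP
open import Data.List.Membership.Propositional using (_∈_)
open import Data.List.Membership.Propositional.Properties using (∈-map⁺; ∈-++⁺ˡ; ∈-++⁺ʳ; ∈-deduplicate⁺)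
open import Data.List.Relation.Unary.All as All using (All; []; _∷_)
import Data.List.Relation.Unary.All.Properties as AllP
open import Data.List.Relation.Unary.Any using (here; there)
open import Data.List.Relation.Unary.AllPairs using (_∷_)
open import Data.List.Relation.Unary.Unique.Propositional using (Unique)
open import Data.List.Relation.Unary.Unique.DecPropositional.Properties using (deduplicate-!)
open import Relation.Binary.Bundles using (Setoid)
import Relation.Binary.Reasoning.Setoid as SetoidReasoning
open import Relation.Binary.PropositionalEquality hiding ([_]; J)
open import Relation.Nullary using (Dec; yes; no)
open import Relation.Nullary.Decidable using (does; dec-true; dec-false)
open +-*-Solver using (solve; _:=_; _:+_; _:*_; _:-_; con)

-- Polynomials in t, x, y up to equality of coefficients

Term : Set
Term = ℚ × ℕ × Word

term-cong : ∀ {c c' : ℚ} {n n' : ℕ} {w w' : Word} → c ≡ c' → n ≡ n' → w ≡ w' → (c , n , w) ≡ (c' , n' , w')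
term-cong refl refl refl = refl

opaque
  termCoeff : ℕ → Word → Term → ℚ
  termCoeff n w (c , n' , w') = if does (n ℕ.≟ n') ∧ does (w ≟W w') then c else 0ℚ

  coeff-∷ : ∀ t P n w → coeff (t ∷ P) n w ≡ termCoeff n w t ℚ.+ coeff P n w
  coeff-∷ (c , n' , w') P n w with does (n ℕ.≟ n') ∧ does (w ≟W w')
  ... | true = refl
  ... | false = sym (QP.+-identityˡ _)

  termCoeff-hit : ∀ n w c → termCoeff n w (c , n , w) ≡ c
  termCoeff-hit n w c rewrite dec-true (n ℕ.≟ n) refl | dec-true (w ≟W w) refl = refl

  termCoeff-miss : ∀ {n w n' w'} c → (n , w) ≢ (n' , w') → termCoeff n w (c , n' , w') ≡ 0ℚ
  termCoeff-miss {n} {w} {n'} {w'} c ne with n ℕ.≟ n'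
  ... | yes refl rewrite dec-true (n ℕ.≟ n) refl | dec-false (w ≟W w') (ne ∘ cong (n ,_)) = refl
  ... | no n≢n' rewrite dec-false (n ℕ.≟ n') n≢n' = refl

_≟ₘ_ : (k k' : ℕ × Word) → Dec (k ≡ k')
_≟ₘ_ = PP.≡-dec ℕ._≟_ _≟W_

termCoeff-onCoeff : ∀ (h : ℚ → ℚ) → h 0ℚ ≡ 0ℚ → ∀ n w c k →
  termCoeff n w (h c , k) ≡ h (termCoeff n w (c , k))
termCoeff-onCoeff h h0 n w c k with (n , w) ≟ₘ k
... | yes refl = trans (termCoeff-hit n w (h c)) (cong h (sym (termCoeff-hit n w c)))
... | no ne = trans (termCoeff-miss (h c) ne) (trans (sym h0) (cong h (sym (termCoeff-miss c ne))))

coeff-++ : ∀ P Q n w → coeff (P ++ Q) n w ≡ coeff P n w ℚ.+ coeff Q n w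
coeff-++ [] Q n w = sym (QP.+-identityˡ _)
coeff-++ (t ∷ P) Q n w = begin
  coeff (t ∷ P ++ Q) n w                              ≡⟨ coeff-∷ t (P ++ Q) n w ⟩
  termCoeff n w t ℚ.+ coeff (P ++ Q) n w              ≡⟨ cong (termCoeff n w t ℚ.+_) (coeff-++ P Q n w) ⟩
  termCoeff n w t ℚ.+ (coeff P n w ℚ.+ coeff Q n w)  ≡⟨ QP.+-assoc (termCoeff n w t) (coeff P n w) (coeff Q n w) ⟨
  (termCoeff n w t ℚ.+ coeff P n w) ℚ.+ coeff Q n w  ≡⟨ cong (ℚ._+ coeff Q n w) (coeff-∷ t P n w) ⟨
  coeff (t ∷ P) n w ℚ.+ coeff Q n w                  ∎
  where open ≡-Reasoning

onCoeff : (ℚ → ℚ) → Term → Term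
onCoeff h (c , k) = (h c , k)

coeff-onCoeff : ∀ (h : ℚ → ℚ) → h 0ℚ ≡ 0ℚ → (∀ x y → h (x ℚ.+ y) ≡ h x ℚ.+ h y) →
  ∀ P n w → coeff (map (onCoeff h) P) n w ≡ h (coeff P n w)
coeff-onCoeff h h0 h+ [] n w = sym h0
coeff-onCoeff h h0 h+ ((c , k) ∷ P) n w = begin
  coeff (map (onCoeff h) ((c , k) ∷ P)) n w                 ≡⟨ coeff-∷ (h c , k) (map (onCoeff h) P) n w ⟩
  termCoeff n w (h c , k) ℚ.+ coeff (map (onCoeff h) P) n w ≡⟨ cong₂ ℚ._+_ (termCoeff-onCoeff h h0 n w c k) (coeff-onCoeff h h0 h+ P n w) ⟩
  h (termCoeff n w (c , k)) ℚ.+ h (coeff P n w)             ≡⟨ h+ _ _ ⟨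
  h (termCoeff n w (c , k) ℚ.+ coeff P n w)                 ≡⟨ cong h (coeff-∷ (c , k) P n w) ⟨
  h (coeff ((c , k) ∷ P) n w)                               ∎
  where open ≡-Reasoning

infix 4 _≋_
record _≋_ (P Q : Poly) : Set where
  constructor ≋i
  field ≋e : ∀ n w → coeff P n w ≡ coeff Q n w
open _≋_ public

≋-refl : ∀ {P} → P ≋ P
≋-refl = ≋i λ n w → refl

≋-sym : ∀ {P Q} → P ≋ Q → Q ≋ P
≋-sym e = ≋i λ n w → sym (≋e e n w)

≋-trans : ∀ {P Q R} → P ≋ Q → Q ≋ R → P ≋ R
≋-trans e f = ≋i λ n w → trans (≋e e n w) (≋e f n w)

≡⇒≋ : ∀ {P Q} → P ≡ Q → P ≋ Q
≡⇒≋ refl = ≋-refl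

≋-setoid : Setoid 0ℓ 0ℓ
≋-setoid = record
  { Carrier = Poly
  ; _≈_ = _≋_
  ; isEquivalence = record { refl = ≋-refl ; sym = ≋-sym ; trans = ≋-trans }
  }

module ≋-Reasoning = SetoidReasoning ≋-setoid

++-cong : ∀ {P P' Q Q'} → P ≋ P' → Q ≋ Q' → P ++ Q ≋ P' ++ Q'
++-cong {P} {P'} {Q} {Q'} e f = ≋i λ n w →
  trans (coeff-++ P Q n w) (trans (cong₂ ℚ._+_ (≋e e n w) (≋e f n w)) (sym (coeff-++ P' Q' n w)))

++-comm≋ : ∀ P Q → P ++ Q ≋ Q ++ P
++-comm≋ P Q = ≋i λ n w → trans (coeff-++ P Q n w) (trans (QP.+-comm (coeff P n w) (coeff Q n w)) (sym (coeff-++ Q P n w)))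

++-assoc≋ : ∀ P Q R → (P ++ Q) ++ R ≋ P ++ (Q ++ R)
++-assoc≋ P Q R = ≡⇒≋ (LP.++-assoc P Q R)

++-identityʳ≋ : ∀ P → P ++ [] ≋ P
++-identityʳ≋ P = ≡⇒≋ (LP.++-identityʳ P)

++-swapʳ≋ : ∀ P Q R → (P ++ Q) ++ R ≋ (P ++ R) ++ Q
++-swapʳ≋ P Q R = begin
  (P ++ Q) ++ R  ≈⟨ ++-assoc≋ P Q R ⟩
  P ++ (Q ++ R)  ≈⟨ ++-cong (≋-refl {P}) (++-comm≋ Q R) ⟩
  P ++ (R ++ Q)  ≈⟨ ++-assoc≋ P R Q ⟨
  (P ++ R) ++ Q  ∎
  where open ≋-Reasoning

++-interchange≋ : ∀ P Q R S → (P ++ Q) ++ (R ++ S) ≋ (P ++ R) ++ (Q ++ S)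
++-interchange≋ P Q R S = begin
  (P ++ Q) ++ (R ++ S)  ≈⟨ ++-assoc≋ P Q (R ++ S) ⟩
  P ++ (Q ++ (R ++ S))  ≈⟨ ++-cong (≋-refl {P}) (++-swapʳ≋ [] Q (R ++ S)) ⟩
  P ++ ((R ++ S) ++ Q)  ≈⟨ ++-cong (≋-refl {P}) (++-swapʳ≋ R S Q) ⟩
  P ++ ((R ++ Q) ++ S)  ≈⟨ ++-cong (≋-refl {P}) (++-assoc≋ R Q S) ⟩
  P ++ (R ++ (Q ++ S))  ≈⟨ ++-assoc≋ P R (Q ++ S) ⟨
  (P ++ R) ++ (Q ++ S)  ∎
  where open ≋-Reasoning

lmulTerm : Letter → Term → Term
lmulTerm a (c , n , w) = (c , n , a ∷ w)

lmul : Letter → Poly → Poly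
lmul a = map (lmulTerm a)

tmulTerm : Term → Term
tmulTerm (c , n , w) = (c , suc n , w)

tmul : Poly → Poly
tmul = map tmulTerm

negTerm : Term → Term
negTerm = onCoeff (ℚ.-_)

neg : Poly → Poly
neg = map negTerm

scaleTerm : ℚ → Term → Term
scaleTerm q = onCoeff (q ℚ.*_)

scale : ℚ → Poly → Poly
scale q = map (scaleTerm q)

one : Poly
one = (1ℚ , 0 , []) ∷ []

coeff-neg : ∀ P n w → coeff (neg P) n w ≡ ℚ.- coeff P n w
coeff-neg = coeff-onCoeff (ℚ.-_) refl QP.neg-distrib-+

coeff-scale : ∀ q P n w → coeff (scale q P) n w ≡ q ℚ.* coeff P n w
coeff-scale q = coeff-onCoeff (q ℚ.*_) (QP.*-zeroʳ q) (QP.*-distribˡ-+ q)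

++-neg-cancel : ∀ P Q → (P ++ Q) ++ neg Q ≋ P
++-neg-cancel P Q = ≋i λ n w → begin
  coeff ((P ++ Q) ++ neg Q) n w                     ≡⟨ coeff-++ (P ++ Q) (neg Q) n w ⟩
  coeff (P ++ Q) n w ℚ.+ coeff (neg Q) n w          ≡⟨ cong₂ ℚ._+_ (coeff-++ P Q n w) (coeff-neg Q n w) ⟩
  (coeff P n w ℚ.+ coeff Q n w) ℚ.+ ℚ.- coeff Q n w ≡⟨ QP.+-assoc (coeff P n w) (coeff Q n w) (ℚ.- coeff Q n w) ⟩
  coeff P n w ℚ.+ (coeff Q n w ℚ.+ ℚ.- coeff Q n w) ≡⟨ cong (coeff P n w ℚ.+_) (QP.+-inverseʳ (coeff Q n w)) ⟩
  coeff P n w ℚ.+ 0ℚ                                ≡⟨ QP.+-identityʳ _ ⟩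
  coeff P n w                                       ∎
  where open ≡-Reasoning

sumOver : List (ℕ × Word) → (ℕ × Word → ℚ) → ℚ
sumOver [] f = 0ℚ
sumOver (k ∷ K) f = f k ℚ.+ sumOver K f

sumOver-cong : ∀ K {f g} → (∀ k → f k ≡ g k) → sumOver K f ≡ sumOver K g
sumOver-cong [] e = refl
sumOver-cong (k ∷ K) e = cong₂ ℚ._+_ (e k) (sumOver-cong K e)

sumOver-+ : ∀ K f g → sumOver K (λ k → f k ℚ.+ g k) ≡ sumOver K f ℚ.+ sumOver K g
sumOver-+ [] f g = sym (QP.+-identityˡ 0ℚ)
sumOver-+ (k ∷ K) f g = trans (cong (f k ℚ.+ g k ℚ.+_) (sumOver-+ K f g)) (interchange (f k) (g k) _ _)
  where
  interchange : ∀ a b c d → (a ℚ.+ b) ℚ.+ (c ℚ.+ d) ≡ (a ℚ.+ c) ℚ.+ (b ℚ.+ d)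
  interchange = solve 4 (λ a b c d → (a :+ b) :+ (c :+ d) := (a :+ c) :+ (b :+ d)) refl

sumOver-zero : ∀ {K f} → All (λ k → f k ≡ 0ℚ) K → sumOver K f ≡ 0ℚ
sumOver-zero [] = refl
sumOver-zero (z ∷ zs) = trans (cong₂ ℚ._+_ z (sumOver-zero zs)) (QP.+-identityʳ 0ℚ)

sumOver-single : ∀ {K x f} → Unique K → x ∈ K → (∀ k → k ≢ x → f k ≡ 0ℚ) → sumOver K f ≡ f x
sumOver-single {f = f} (x∉K ∷ _) (here refl) vanish =
  trans (cong (f _ ℚ.+_) (sumOver-zero (All.map (λ x≢k → vanish _ (x≢k ∘ sym)) x∉K))) (QP.+-identityʳ _)
sumOver-single {x = x} {f} (k∉K ∷ uK) (there x∈K) vanish =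
  trans (cong₂ ℚ._+_ (vanish _ (λ k≡x → All.lookup k∉K x∈K k≡x)) (sumOver-single uK x∈K vanish)) (QP.+-identityˡ (f x))

linearForm : (ℕ × Word → ℚ) → Poly → ℚ
linearForm g [] = 0ℚ
linearForm g ((c , k) ∷ P) = c ℚ.* g k ℚ.+ linearForm g P

monomial : Term → ℕ × Word
monomial (_ , k) = k

linearForm-expand : ∀ g {K} P → Unique K → All (λ t → monomial t ∈ K) P →
  linearForm g P ≡ sumOver K (λ (n , w) → coeff P n w ℚ.* g (n , w))
linearForm-expand g {K} [] uK cov = sym (sumOver-zero (All.universal (λ k → QP.*-zeroˡ (g k)) K))
linearForm-expand g {K} ((c , n , w) ∷ P) uK (k∈K ∷ cov) = sym (begin
  sumOver K (λ k → coeff (t ∷ P) (proj₁ k) (proj₂ k) ℚ.* g k)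
    ≡⟨ sumOver-cong K (λ (n' , w') → trans (cong (ℚ._* g (n' , w')) (coeff-∷ t P n' w')) (QP.*-distribʳ-+ (g (n' , w')) (termCoeff n' w' t) (coeff P n' w'))) ⟩
  sumOver K (λ k → termCoeff (proj₁ k) (proj₂ k) t ℚ.* g k ℚ.+ coeff P (proj₁ k) (proj₂ k) ℚ.* g k)
    ≡⟨ sumOver-+ K _ _ ⟩
  sumOver K (λ k → termCoeff (proj₁ k) (proj₂ k) t ℚ.* g k) ℚ.+ sumOver K (λ k → coeff P (proj₁ k) (proj₂ k) ℚ.* g k)
    ≡⟨ cong₂ ℚ._+_ (trans (sumOver-single uK k∈K miss) (cong (ℚ._* g (n , w)) (termCoeff-hit n w c)))
                   (sym (linearForm-expand g P uK cov)) ⟩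
  c ℚ.* g (n , w) ℚ.+ linearForm g P ∎)
  where
  open ≡-Reasoning
  t = (c , n , w)
  miss : ∀ k → k ≢ (n , w) → termCoeff (proj₁ k) (proj₂ k) t ℚ.* g k ≡ 0ℚ
  miss k k≢ = trans (cong (ℚ._* g k) (termCoeff-miss c k≢)) (QP.*-zeroˡ (g k))

-- A linear form sees only coefficients: expand both sides over the duplicate-free monomials of P ++ Q.
linearForm-cong : ∀ g {P Q} → P ≋ Q → linearForm g P ≡ linearForm g Q
linearForm-cong g {P} {Q} e = begin
  linearForm g P                                               ≡⟨ linearForm-expand g P uK (covers ∈-++⁺ˡ) ⟩
  sumOver K (λ (n , w) → coeff P n w ℚ.* g (n , w))          ≡⟨ sumOver-cong K (λ (n , w) → cong (ℚ._* g (n , w)) (≋e e n w)) ⟩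
  sumOver K (λ (n , w) → coeff Q n w ℚ.* g (n , w))          ≡⟨ linearForm-expand g Q uK (covers (∈-++⁺ʳ P)) ⟨
  linearForm g Q                                               ∎
  where
  open ≡-Reasoning
  K = deduplicate _≟ₘ_ (map monomial (P ++ Q))
  uK : Unique K
  uK = deduplicate-! _≟ₘ_ (map monomial (P ++ Q))
  covers : ∀ {R} → (∀ {t} → t ∈ R → t ∈ P ++ Q) → All (λ t → monomial t ∈ K) R
  covers sub = All.tabulate (λ t∈R → ∈-deduplicate⁺ _≟ₘ_ (∈-map⁺ monomial (sub t∈R)))

concatMap-linear-cong : ∀ (G : Term → Poly) → (∀ c n w → G (c , n , w) ≋ scale c (G (1ℚ , n , w))) →
  ∀ {P Q} → P ≋ Q → concatMap G P ≋ concatMap G Q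
concatMap-linear-cong G linear {P} {Q} e = ≋i λ n w →
  trans (asLinearForm n w P) (trans (linearForm-cong (λ (n' , w') → coeff (G (1ℚ , n' , w')) n w) e) (sym (asLinearForm n w Q)))
  where
  asLinearForm : ∀ n w P → coeff (concatMap G P) n w ≡ linearForm (λ (n' , w') → coeff (G (1ℚ , n' , w')) n w) P
  asLinearForm n w [] = refl
  asLinearForm n w ((c , n' , w') ∷ P) = trans (coeff-++ (G (c , n' , w')) (concatMap G P) n w)
    (cong₂ ℚ._+_ (trans (≋e (linear c n' w') n w) (coeff-scale c (G (1ℚ , n' , w')) n w)) (asLinearForm n w P))

map-as-concatMap : ∀ {A B : Set} (g : A → B) L → map g L ≡ concatMap (λ v → g v ∷ []) L
map-as-concatMap g L = trans (sym (LP.concatMap-pure (map g L))) (LP.concatMap-map [_] g L)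

map-map : ∀ {A B C : Set} (g : B → C) (f : A → B) L → map g (map f L) ≡ map (g ∘ f) L
map-map g f L = sym (LP.map-∘ L)

map-linear-cong : ∀ (f : Term → Term) → (∀ c n w → f (c , n , w) ≡ scaleTerm c (f (1ℚ , n , w))) →
  ∀ {P Q} → P ≋ Q → map f P ≋ map f Q
map-linear-cong f linear {P} {Q} e = begin
  map f P                           ≡⟨ map-as-concatMap f P ⟩
  concatMap (λ t → f t ∷ []) P      ≈⟨ concatMap-linear-cong (λ t → f t ∷ []) (λ c n w → ≡⇒≋ (cong (_∷ []) (linear c n w))) e ⟩
  concatMap (λ t → f t ∷ []) Q      ≡⟨ map-as-concatMap f Q ⟨
  map f Q                           ∎
  where open ≋-Reasoning

lmul-cong : ∀ a {P Q} → P ≋ Q → lmul a P ≋ lmul a Q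
lmul-cong a = map-linear-cong (lmulTerm a) (λ c n w → cong (λ c' → (c' , n , a ∷ w)) (sym (QP.*-identityʳ c)))

tmul-cong : ∀ {P Q} → P ≋ Q → tmul P ≋ tmul Q
tmul-cong = map-linear-cong tmulTerm (λ c n w → cong (λ c' → (c' , suc n , w)) (sym (QP.*-identityʳ c)))

lmul-tmul : ∀ a P → lmul a (tmul P) ≡ tmul (lmul a P)
lmul-tmul a P = trans (map-map (lmulTerm a) tmulTerm P) (sym (map-map tmulTerm (lmulTerm a) P))

concatMap-cong≋ : ∀ {A : Set} {f g : A → Poly} → (∀ x → f x ≋ g x) → ∀ L → concatMap f L ≋ concatMap g L
concatMap-cong≋ e [] = ≋-refl
concatMap-cong≋ e (x ∷ L) = ++-cong (e x) (concatMap-cong≋ e L)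

concatMap-cong≋-All : ∀ {A : Set} {f g : A → Poly} {L} → All (λ x → f x ≋ g x) L → concatMap f L ≋ concatMap g L
concatMap-cong≋-All [] = ≋-refl
concatMap-cong≋-All (e ∷ es) = ++-cong e (concatMap-cong≋-All es)

concatMap-split : ∀ {A : Set} (f g : A → Poly) L → concatMap (λ x → f x ++ g x) L ≋ concatMap f L ++ concatMap g L
concatMap-split f g [] = ≋-refl
concatMap-split f g (x ∷ L) = begin
  (f x ++ g x) ++ concatMap (λ x → f x ++ g x) L ≈⟨ ++-cong (≋-refl {f x ++ g x}) (concatMap-split f g L) ⟩
  (f x ++ g x) ++ (concatMap f L ++ concatMap g L) ≈⟨ ++-interchange≋ (f x) (g x) (concatMap f L) (concatMap g L) ⟩
  (f x ++ concatMap f L) ++ (g x ++ concatMap g L) ∎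
  where open ≋-Reasoning

concatMap-const-[] : ∀ {A : Set} L → concatMap {A = A} {B = Term} (λ _ → []) L ≡ []
concatMap-const-[] [] = refl
concatMap-const-[] (x ∷ L) = concatMap-const-[] L

sumBelow : ℕ → (ℕ → Poly) → Poly
sumBelow zero f = []
sumBelow (suc n) f = f 0 ++ sumBelow n (f ∘ suc)

concatMap-applyUpTo : ∀ (f : ℕ → Poly) g n → concatMap f (applyUpTo g n) ≡ sumBelow n (f ∘ g)
concatMap-applyUpTo f g zero = refl
concatMap-applyUpTo f g (suc n) = cong (f (g 0) ++_) (concatMap-applyUpTo f (g ∘ suc) n)

concatMap-upTo : ∀ (f : ℕ → Poly) n → concatMap f (upTo n) ≡ sumBelow n f
concatMap-upTo f n = concatMap-applyUpTo f (λ x → x) n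

sumBelow-suc : ∀ n f → sumBelow (suc n) f ≡ sumBelow n f ++ f n
sumBelow-suc zero f = LP.++-identityʳ (f 0)
sumBelow-suc (suc n) f = trans (cong (f 0 ++_) (sumBelow-suc n (f ∘ suc))) (sym (LP.++-assoc (f 0) _ _))

sumBelow-cong≋ : ∀ n {f g} → (∀ i → i < n → f i ≋ g i) → sumBelow n f ≋ sumBelow n g
sumBelow-cong≋ zero e = ≋-refl
sumBelow-cong≋ (suc n) e = ++-cong (e 0 (s≤s z≤n)) (sumBelow-cong≋ n (λ i i<n → e (suc i) (s≤s i<n)))

sumBelow-cong : ∀ n {f g} → (∀ i → i < n → f i ≡ g i) → sumBelow n f ≡ sumBelow n g
sumBelow-cong zero e = refl
sumBelow-cong (suc n) e = cong₂ _++_ (e 0 (s≤s z≤n)) (sumBelow-cong n (λ i i<n → e (suc i) (s≤s i<n)))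

sumBelow-split : ∀ n f g → sumBelow n (λ i → f i ++ g i) ≋ sumBelow n f ++ sumBelow n g
sumBelow-split zero f g = ≋-refl
sumBelow-split (suc n) f g = ≋-trans (++-cong (≋-refl {f 0 ++ g 0}) (sumBelow-split n (f ∘ suc) (g ∘ suc)))
  (++-interchange≋ (f 0) (g 0) _ _)

sumBelow-zero : ∀ n {f} → (∀ i → i < n → f i ≋ []) → sumBelow n f ≋ []
sumBelow-zero zero e = ≋-refl
sumBelow-zero (suc n) {f} e = ++-cong {f 0} {[]} {sumBelow n (f ∘ suc)} {[]} (e 0 (s≤s z≤n)) (sumBelow-zero n (λ i i<n → e (suc i) (s≤s i<n)))

map-sumBelow : ∀ (h : Term → Term) n f → map h (sumBelow n f) ≡ sumBelow n (map h ∘ f)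
map-sumBelow h zero f = refl
map-sumBelow h (suc n) f = trans (LP.map-++ h (f 0) _) (cong (map h (f 0) ++_) (map-sumBelow h n (f ∘ suc)))

sumBelow-concatMap : ∀ {A : Set} n (f : ℕ → A → Poly) L →
  sumBelow n (λ i → concatMap (f i) L) ≋ concatMap (λ a → sumBelow n (λ i → f i a)) L
sumBelow-concatMap zero f L = ≡⇒≋ (sym (concatMap-const-[] L))
sumBelow-concatMap (suc n) f L = ≋-trans (++-cong (≋-refl {concatMap (f 0) L}) (sumBelow-concatMap n (f ∘ suc) L))
  (≋-sym (concatMap-split (f 0) (λ a → sumBelow n (λ i → f (suc i) a)) L))

sumBelow-single : ∀ n j f → j < n → (∀ i → i < n → i ≢ j → f i ≋ []) → sumBelow n f ≋ f j
sumBelow-single (suc n) zero f j<n e =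
  ≋-trans (++-cong (≋-refl {f 0}) (sumBelow-zero n (λ i i<n → e (suc i) (s≤s i<n) (λ ())))) (++-identityʳ≋ (f 0))
sumBelow-single (suc n) (suc j) f (s≤s j<n) e =
  ≋-trans (++-cong (e 0 (s≤s z≤n) (λ ())) (sumBelow-single n j (f ∘ suc) j<n (λ i i<n ne → e (suc i) (s≤s i<n) (λ q → ne (NP.suc-injective q))))) ≋-refl

-- The involution τ and the substitution σ on words

swapL-involutive : ∀ a → swapL (swapL a) ≡ a
swapL-involutive 𝕩 = refl
swapL-involutive 𝕪 = refl

τw-∷ : ∀ a w → τw (a ∷ w) ≡ τw w ++ [ swapL a ]
τw-∷ a w = LP.unfold-reverse (swapL a) (map swapL w)

τw-snoc : ∀ v a → τw (v ++ [ a ]) ≡ swapL a ∷ τw v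
τw-snoc v a = begin
  reverse (map swapL (v ++ [ a ])) ≡⟨ cong reverse (LP.map-++ swapL v [ a ]) ⟩
  reverse (map swapL v ++ [ swapL a ]) ≡⟨ LP.reverse-++ (map swapL v) [ swapL a ] ⟩
  swapL a ∷ τw v ∎
  where open ≡-Reasoning

τw-involutive : ∀ w → τw (τw w) ≡ w
τw-involutive [] = refl
τw-involutive (a ∷ w) = trans (cong τw (τw-∷ a w)) (trans (τw-snoc (τw w) (swapL a)) (cong₂ _∷_ (swapL-involutive a) (τw-involutive w)))

replicate-++-∷ : ∀ {A : Set} n (a : A) Z → replicate n a ++ a ∷ Z ≡ a ∷ replicate n a ++ Z
replicate-++-∷ zero a Z = refl
replicate-++-∷ (suc n) a Z = cong (a ∷_) (replicate-++-∷ n a Z)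

reverse-replicate : ∀ {A : Set} n (a : A) → reverse (replicate n a) ≡ replicate n a
reverse-replicate zero a = refl
reverse-replicate (suc n) a = trans (LP.unfold-reverse a (replicate n a)) (trans (cong (_++ [ a ]) (reverse-replicate n a))
  (trans (replicate-++-∷ n a []) (cong (a ∷_) (LP.++-identityʳ (replicate n a)))))

τw-++ : ∀ u v → τw (u ++ v) ≡ τw v ++ τw u
τw-++ u v = trans (cong reverse (LP.map-++ swapL u v)) (LP.reverse-++ (map swapL u) (map swapL v))

τw-replicate : ∀ n a → τw (replicate n a) ≡ replicate n (swapL a)
τw-replicate n a = trans (cong reverse (LP.map-replicate swapL n a)) (reverse-replicate n (swapL a))

concatMap-concatMap : ∀ {A B C : Set} (f : B → List C) (g : A → List B) L → concatMap f (concatMap g L) ≡ concatMap (concatMap f ∘ g) L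
concatMap-concatMap f g [] = refl
concatMap-concatMap f g (x ∷ L) = trans (LP.concatMap-++ f (g x) (concatMap g L)) (cong (concatMap f (g x) ++_) (concatMap-concatMap f g L))

infix 20 𝕩^_

𝕩^_ : ℕ → Word
𝕩^ i = replicate i 𝕩

y𝕩^ : ℕ → Word → Word
y𝕩^ i v = 𝕪 ∷ 𝕩^ i ++ v

σw-y : ∀ j w → σw j (𝕪 ∷ w) ≡ concatMap (λ i → map (y𝕩^ i) (σw (j ∸ i) w)) (upTo (suc j))
σw-y zero w = refl
σw-y (suc j) w = refl

σw-x : ∀ j w → σw j (𝕩 ∷ w) ≡ map (𝕩 ∷_) (σw j w)
σw-x zero w = refl
σw-x (suc j) w = refl

σw-zero : ∀ w → σw 0 w ≡ [ w ]
σw-zero [] = refl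
σw-zero (𝕩 ∷ w) = cong (map (𝕩 ∷_)) (σw-zero w)
σw-zero (𝕪 ∷ w) = cong (λ z → map (λ v → 𝕪 ∷ [] ++ v) z ++ []) (σw-zero w)

concatMap-σw-y : ∀ F j w → concatMap F (σw j (𝕪 ∷ w)) ≡ sumBelow (suc j) (λ i → concatMap (F ∘ y𝕩^ i) (σw (j ∸ i) w))
concatMap-σw-y F j w = begin
  concatMap F (σw j (𝕪 ∷ w))                                          ≡⟨ cong (concatMap F) (σw-y j w) ⟩
  concatMap F (concatMap (λ i → map (y𝕩^ i) (σw (j ∸ i) w)) (upTo (suc j)))
    ≡⟨ concatMap-concatMap F (λ i → map (y𝕩^ i) (σw (j ∸ i) w)) (upTo (suc j)) ⟩
  concatMap (λ i → concatMap F (map (y𝕩^ i) (σw (j ∸ i) w))) (upTo (suc j))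
    ≡⟨ LP.concatMap-cong (λ i → LP.concatMap-map F (y𝕩^ i) (σw (j ∸ i) w)) (upTo (suc j)) ⟩
  concatMap (λ i → concatMap (F ∘ y𝕩^ i) (σw (j ∸ i) w)) (upTo (suc j))
    ≡⟨ concatMap-upTo (λ i → concatMap (F ∘ y𝕩^ i) (σw (j ∸ i) w)) (suc j) ⟩
  sumBelow (suc j) (λ i → concatMap (F ∘ y𝕩^ i) (σw (j ∸ i) w))     ∎
  where open ≡-Reasoning

σw-[]-vanish : ∀ {i j} → i < j → σw (j ∸ i) [] ≡ []
σw-[]-vanish {i} {j} i<j with j ∸ i in eq
... | zero = ⊥-elim (NP.<⇒≱ i<j (NP.m∸n≡0⇒m≤n eq))
... | suc _ = refl

concatMap-σw-y[] : ∀ F j → concatMap F (σw j (𝕪 ∷ [])) ≋ F (y𝕩^ j [])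
concatMap-σw-y[] F j = begin
  concatMap F (σw j (𝕪 ∷ []))                                   ≡⟨ concatMap-σw-y F j [] ⟩
  sumBelow (suc j) (λ i → concatMap (F ∘ y𝕩^ i) (σw (j ∸ i) []))
    ≈⟨ sumBelow-single (suc j) j _ (NP.n<1+n j) (λ i i≤j i≢j → ≡⇒≋ (cong (concatMap (F ∘ y𝕩^ i)) (σw-[]-vanish (NP.≤∧≢⇒< (NP.≤-pred i≤j) i≢j)))) ⟩
  concatMap (F ∘ y𝕩^ j) (σw (j ∸ j) [])                          ≡⟨ cong (λ n → concatMap (F ∘ y𝕩^ j) (σw n [])) (NP.n∸n≡0 j) ⟩
  F (y𝕩^ j []) ++ []                                             ≈⟨ ++-identityʳ≋ (F (y𝕩^ j [])) ⟩
  F (y𝕩^ j [])                                                   ∎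
  where open ≋-Reasoning

𝕩^-snoc : ∀ j → 𝕩^ j ++ [ 𝕩 ] ≡ 𝕩 ∷ 𝕩^ j
𝕩^-snoc zero = refl
𝕩^-snoc (suc j) = cong (𝕩 ∷_) (𝕩^-snoc j)

y𝕩^-snoc : ∀ i v a → y𝕩^ i v ++ [ a ] ≡ y𝕩^ i (v ++ [ a ])
y𝕩^-snoc i v a = cong (𝕪 ∷_) (LP.++-assoc (𝕩^ i) v [ a ])

-- Coefficientwise form of σ(u y) = σ(u) y + σ(u y) x u, i.e. of y(1 − xu)⁻¹ = y + y(1 − xu)⁻¹ x u.
concatMap-σw-suc-snoc-y : ∀ u (F : Word → Poly) j → concatMap F (σw (suc j) (u ++ [ 𝕪 ])) ≋
  concatMap (F ∘ (_++ [ 𝕪 ])) (σw (suc j) u) ++ concatMap (F ∘ (_++ [ 𝕩 ])) (σw j (u ++ [ 𝕪 ]))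
concatMap-σw-suc-snoc-y [] F j = begin
  concatMap F (σw (suc j) (𝕪 ∷ []))           ≈⟨ concatMap-σw-y[] F (suc j) ⟩
  F (y𝕩^ (suc j) [])                          ≡⟨ cong (λ v → F (𝕪 ∷ v)) (trans (LP.++-identityʳ (𝕩^ suc j)) (sym (trans (cong (_++ [ 𝕩 ]) (LP.++-identityʳ (𝕩^ j))) (𝕩^-snoc j)))) ⟩
  F (y𝕩^ j [] ++ [ 𝕩 ])                       ≈⟨ concatMap-σw-y[] (F ∘ (_++ [ 𝕩 ])) j ⟨
  concatMap (F ∘ (_++ [ 𝕩 ])) (σw j (𝕪 ∷ []))  ∎
  where open ≋-Reasoning
concatMap-σw-suc-snoc-y (𝕩 ∷ u) F j = begin
  concatMap F (σw (suc j) (𝕩 ∷ u ++ [ 𝕪 ]))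
    ≡⟨ LP.concatMap-map F (𝕩 ∷_) (σw (suc j) (u ++ [ 𝕪 ])) ⟩
  concatMap (F ∘ (𝕩 ∷_)) (σw (suc j) (u ++ [ 𝕪 ]))
    ≈⟨ concatMap-σw-suc-snoc-y u (F ∘ (𝕩 ∷_)) j ⟩
  concatMap (F ∘ (𝕩 ∷_) ∘ (_++ [ 𝕪 ])) (σw (suc j) u) ++ concatMap (F ∘ (𝕩 ∷_) ∘ (_++ [ 𝕩 ])) (σw j (u ++ [ 𝕪 ]))
    ≡⟨ cong₂ _++_ (LP.concatMap-map (F ∘ (_++ [ 𝕪 ])) (𝕩 ∷_) (σw (suc j) u))
                  (trans (cong (concatMap (F ∘ (_++ [ 𝕩 ]))) (σw-x j (u ++ [ 𝕪 ])))
                         (LP.concatMap-map (F ∘ (_++ [ 𝕩 ])) (𝕩 ∷_) (σw j (u ++ [ 𝕪 ])))) ⟨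
  concatMap (F ∘ (_++ [ 𝕪 ])) (σw (suc j) (𝕩 ∷ u)) ++ concatMap (F ∘ (_++ [ 𝕩 ])) (σw j (𝕩 ∷ u ++ [ 𝕪 ]))
    ∎
  where open ≋-Reasoning
concatMap-σw-suc-snoc-y (𝕪 ∷ u) F j = begin
  concatMap F (σw (suc j) (𝕪 ∷ u ++ [ 𝕪 ]))
    ≡⟨ concatMap-σw-y F (suc j) (u ++ [ 𝕪 ]) ⟩
  sumBelow (suc (suc j)) L
    ≡⟨ sumBelow-suc (suc j) L ⟩
  sumBelow (suc j) L ++ L (suc j)
    ≈⟨ ++-cong (sumBelow-cong≋ (suc j) split) last ⟩
  sumBelow (suc j) (λ i → R i ++ T i) ++ R (suc j)
    ≈⟨ ++-cong (sumBelow-split (suc j) R T) (≋-refl {R (suc j)}) ⟩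
  (sumBelow (suc j) R ++ sumBelow (suc j) T) ++ R (suc j)
    ≈⟨ ++-swapʳ≋ (sumBelow (suc j) R) (sumBelow (suc j) T) (R (suc j)) ⟩
  (sumBelow (suc j) R ++ R (suc j)) ++ sumBelow (suc j) T
    ≡⟨ cong (_++ sumBelow (suc j) T) (sumBelow-suc (suc j) R) ⟨
  sumBelow (suc (suc j)) R ++ sumBelow (suc j) T
    ≡⟨ cong₂ _++_ (concatMap-σw-y (F ∘ (_++ [ 𝕪 ])) (suc j) u) (concatMap-σw-y (F ∘ (_++ [ 𝕩 ])) j (u ++ [ 𝕪 ])) ⟨
  concatMap (F ∘ (_++ [ 𝕪 ])) (σw (suc j) (𝕪 ∷ u)) ++ concatMap (F ∘ (_++ [ 𝕩 ])) (σw j (𝕪 ∷ u ++ [ 𝕪 ]))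
    ∎
  where
  open ≋-Reasoning
  L R T : ℕ → Poly
  L i = concatMap (F ∘ y𝕩^ i) (σw (suc j ∸ i) (u ++ [ 𝕪 ]))
  R i = concatMap (F ∘ (_++ [ 𝕪 ]) ∘ y𝕩^ i) (σw (suc j ∸ i) u)
  T i = concatMap (F ∘ (_++ [ 𝕩 ]) ∘ y𝕩^ i) (σw (j ∸ i) (u ++ [ 𝕪 ]))
  split : ∀ i → i < suc j → L i ≋ R i ++ T i
  split i i≤j rewrite NP.+-∸-assoc 1 (NP.≤-pred i≤j) = begin
    concatMap (F ∘ y𝕩^ i) (σw (suc (j ∸ i)) (u ++ [ 𝕪 ]))
      ≈⟨ concatMap-σw-suc-snoc-y u (F ∘ y𝕩^ i) (j ∸ i) ⟩
    concatMap (F ∘ y𝕩^ i ∘ (_++ [ 𝕪 ])) (σw (suc (j ∸ i)) u) ++ concatMap (F ∘ y𝕩^ i ∘ (_++ [ 𝕩 ])) (σw (j ∸ i) (u ++ [ 𝕪 ]))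
      ≡⟨ cong₂ _++_ (LP.concatMap-cong (λ v → cong F (sym (y𝕩^-snoc i v 𝕪))) (σw (suc (j ∸ i)) u))
                    (LP.concatMap-cong (λ v → cong F (sym (y𝕩^-snoc i v 𝕩))) (σw (j ∸ i) (u ++ [ 𝕪 ]))) ⟩
    concatMap (F ∘ (_++ [ 𝕪 ]) ∘ y𝕩^ i) (σw (suc (j ∸ i)) u) ++ T i
      ∎
  last : L (suc j) ≋ R (suc j)
  last rewrite NP.n∸n≡0 j | σw-zero (u ++ [ 𝕪 ]) | σw-zero u = ≡⇒≋ (cong (λ v → F v ++ []) (sym (y𝕩^-snoc (suc j) u 𝕪)))

σw-snoc-x : ∀ v j → σw j (v ++ [ 𝕩 ]) ≡ map (_++ [ 𝕩 ]) (σw j v)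
σw-snoc-x [] zero = refl
σw-snoc-x [] (suc j) = refl
σw-snoc-x (𝕩 ∷ v) j = begin
  σw j (𝕩 ∷ v ++ [ 𝕩 ]) ≡⟨ σw-x j (v ++ [ 𝕩 ]) ⟩
  map (𝕩 ∷_) (σw j (v ++ [ 𝕩 ])) ≡⟨ cong (map (𝕩 ∷_)) (σw-snoc-x v j) ⟩
  map (𝕩 ∷_) (map (_++ [ 𝕩 ]) (σw j v)) ≡⟨ trans (map-map (𝕩 ∷_) (_++ [ 𝕩 ]) (σw j v)) (sym (map-map (_++ [ 𝕩 ]) (𝕩 ∷_) (σw j v))) ⟩
  map (_++ [ 𝕩 ]) (map (𝕩 ∷_) (σw j v)) ≡⟨ cong (map (_++ [ 𝕩 ])) (sym (σw-x j v)) ⟩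
  map (_++ [ 𝕩 ]) (σw j (𝕩 ∷ v)) ∎
  where open ≡-Reasoning
σw-snoc-x (𝕪 ∷ v) j = begin
  σw j (𝕪 ∷ v ++ [ 𝕩 ]) ≡⟨ σw-y j (v ++ [ 𝕩 ]) ⟩
  concatMap (λ i → map (y𝕩^ i) (σw (j ∸ i) (v ++ [ 𝕩 ]))) (upTo (suc j))
    ≡⟨ LP.concatMap-cong (λ i → trans (cong (map (y𝕩^ i)) (σw-snoc-x v (j ∸ i)))
         (trans (map-map (y𝕩^ i) (_++ [ 𝕩 ]) (σw (j ∸ i) v))
         (trans (LP.map-cong (λ u → sym (y𝕩^-snoc i u 𝕩)) (σw (j ∸ i) v)) (sym (map-map (_++ [ 𝕩 ]) (y𝕩^ i) (σw (j ∸ i) v)))))) (upTo (suc j)) ⟩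
  concatMap (λ i → map (_++ [ 𝕩 ]) (map (y𝕩^ i) (σw (j ∸ i) v))) (upTo (suc j))
    ≡⟨ sym (LP.map-concatMap (_++ [ 𝕩 ]) (λ i → map (y𝕩^ i) (σw (j ∸ i) v)) (upTo (suc j))) ⟩
  map (_++ [ 𝕩 ]) (concatMap (λ i → map (y𝕩^ i) (σw (j ∸ i) v)) (upTo (suc j))) ≡⟨ cong (map (_++ [ 𝕩 ])) (sym (σw-y j v)) ⟩
  map (_++ [ 𝕩 ]) (σw j (𝕪 ∷ v)) ∎
  where open ≡-Reasoning

-- τστ fixes y and sends x to (1 − yu)⁻¹ x; τστ-term j t is the u^j part of the image of t.
τστ-term : ℕ → Term → Poly
τστ-term j (c , n , w) = map (λ v → (c , n , τw v)) (σw j (τw w))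

τστ-poly : ℕ → Poly → Poly
τστ-poly j P = concatMap (τστ-term j) P

τστ-term-lmul-y : ∀ j t → τστ-term j (lmulTerm 𝕪 t) ≡ lmul 𝕪 (τστ-term j t)
τστ-term-lmul-y j (c , n , w) = begin
  map g (σw j (τw (𝕪 ∷ w))) ≡⟨ cong (λ z → map g (σw j z)) (τw-∷ 𝕪 w) ⟩
  map g (σw j (τw w ++ [ 𝕩 ])) ≡⟨ cong (map g) (σw-snoc-x (τw w) j) ⟩
  map g (map (_++ [ 𝕩 ]) (σw j (τw w))) ≡⟨ map-map g (_++ [ 𝕩 ]) (σw j (τw w)) ⟩
  map (g ∘ (_++ [ 𝕩 ])) (σw j (τw w)) ≡⟨ LP.map-cong (λ v → cong (λ z → (c , n , z)) (τw-snoc v 𝕩)) (σw j (τw w)) ⟩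
  map (lmulTerm 𝕪 ∘ g) (σw j (τw w)) ≡⟨ sym (map-map (lmulTerm 𝕪) g (σw j (τw w))) ⟩
  lmul 𝕪 (map g (σw j (τw w))) ∎
  where open ≡-Reasoning
        g : Word → Term
        g v = (c , n , τw v)

τστ-term-zero : ∀ t → τστ-term 0 t ≡ t ∷ []
τστ-term-zero (c , n , w) = trans (cong (map (λ v → (c , n , τw v))) (σw-zero (τw w))) (cong (λ z → (c , n , z) ∷ []) (τw-involutive w))

τστ-term-suc-lmul-x : ∀ j t → τστ-term (suc j) (lmulTerm 𝕩 t) ≋ lmul 𝕩 (τστ-term (suc j) t) ++ lmul 𝕪 (τστ-term j (lmulTerm 𝕩 t))
τστ-term-suc-lmul-x j (c , n , w) = begin
  map g (σw (suc j) (τw (𝕩 ∷ w))) ≡⟨ cong (λ z → map g (σw (suc j) z)) (τw-∷ 𝕩 w) ⟩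
  map g (σw (suc j) (τw w ++ [ 𝕪 ])) ≡⟨ map-as-concatMap g _ ⟩
  concatMap F (σw (suc j) (τw w ++ [ 𝕪 ])) ≈⟨ concatMap-σw-suc-snoc-y (τw w) F j ⟩
  concatMap (F ∘ (_++ [ 𝕪 ])) (σw (suc j) (τw w)) ++ concatMap (F ∘ (_++ [ 𝕩 ])) (σw j (τw w ++ [ 𝕪 ]))
    ≡⟨ cong₂ _++_ (trans (LP.concatMap-cong (λ v → cong (λ z → (c , n , z) ∷ []) (τw-snoc v 𝕪)) (σw (suc j) (τw w)))
                          (trans (sym (map-as-concatMap (lmulTerm 𝕩 ∘ g) _)) (sym (map-map (lmulTerm 𝕩) g _))))
                  (trans (LP.concatMap-cong (λ v → cong (λ z → (c , n , z) ∷ []) (τw-snoc v 𝕩)) (σw j (τw w ++ [ 𝕪 ])))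
                          (trans (sym (map-as-concatMap (lmulTerm 𝕪 ∘ g) _))
                          (trans (sym (map-map (lmulTerm 𝕪) g _)) (cong (λ z → lmul 𝕪 (map g (σw j z))) (sym (τw-∷ 𝕩 w)))))) ⟩
  lmul 𝕩 (map g (σw (suc j) (τw w))) ++ lmul 𝕪 (map g (σw j (τw (𝕩 ∷ w)))) ∎
  where open ≋-Reasoning
        g : Word → Term
        g v = (c , n , τw v)
        F : Word → Poly
        F v = g v ∷ []

τστ-term-tmul : ∀ j t → τστ-term j (tmulTerm t) ≡ tmul (τστ-term j t)
τστ-term-tmul j (c , n , w) = sym (map-map tmulTerm _ (σw j (τw w)))

τστ-term-neg : ∀ j t → τστ-term j (negTerm t) ≡ neg (τστ-term j t)
τστ-term-neg j (c , n , w) = sym (map-map negTerm _ (σw j (τw w)))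

τστ-poly-++ : ∀ j P Q → τστ-poly j (P ++ Q) ≡ τστ-poly j P ++ τστ-poly j Q
τστ-poly-++ j P Q = LP.concatMap-++ (τστ-term j) P Q

τστ-poly-map : ∀ j (h : Term → Term) (h' : Poly → Poly) → (∀ t → τστ-term j (h t) ≡ h' (τστ-term j t)) →
  (∀ L → h' (concatMap (τστ-term j) L) ≡ concatMap (h' ∘ τστ-term j) L) → ∀ P → τστ-poly j (map h P) ≡ h' (τστ-poly j P)
τστ-poly-map j h h' e d P = trans (LP.concatMap-map (τστ-term j) h P) (trans (LP.concatMap-cong e P) (sym (d P)))

τστ-poly-lmul-y : ∀ j P → τστ-poly j (lmul 𝕪 P) ≡ lmul 𝕪 (τστ-poly j P)
τστ-poly-lmul-y j = τστ-poly-map j (lmulTerm 𝕪) (lmul 𝕪) (τστ-term-lmul-y j) (LP.map-concatMap (lmulTerm 𝕪) (τστ-term j))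

τστ-poly-tmul : ∀ j P → τστ-poly j (tmul P) ≡ tmul (τστ-poly j P)
τστ-poly-tmul j = τστ-poly-map j tmulTerm tmul (τστ-term-tmul j) (LP.map-concatMap tmulTerm (τστ-term j))

τστ-poly-neg : ∀ j P → τστ-poly j (neg P) ≡ neg (τστ-poly j P)
τστ-poly-neg j = τστ-poly-map j negTerm neg (τστ-term-neg j) (LP.map-concatMap negTerm (τστ-term j))

τστ-poly-zero : ∀ P → τστ-poly 0 P ≡ P
τστ-poly-zero [] = refl
τστ-poly-zero (t ∷ P) = trans (cong (_++ τστ-poly 0 P) (τστ-term-zero t)) (cong (t ∷_) (τστ-poly-zero P))

τστ-poly-suc-lmul-x : ∀ j P → τστ-poly (suc j) (lmul 𝕩 P) ≋ lmul 𝕩 (τστ-poly (suc j) P) ++ lmul 𝕪 (τστ-poly j (lmul 𝕩 P))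
τστ-poly-suc-lmul-x j P = begin
  τστ-poly (suc j) (lmul 𝕩 P) ≡⟨ LP.concatMap-map (τστ-term (suc j)) (lmulTerm 𝕩) P ⟩
  concatMap (τστ-term (suc j) ∘ lmulTerm 𝕩) P ≈⟨ concatMap-cong≋ (τστ-term-suc-lmul-x j) P ⟩
  concatMap (λ t → lmul 𝕩 (τστ-term (suc j) t) ++ lmul 𝕪 (τστ-term j (lmulTerm 𝕩 t))) P ≈⟨ concatMap-split _ _ P ⟩
  concatMap (lmul 𝕩 ∘ τστ-term (suc j)) P ++ concatMap (lmul 𝕪 ∘ τστ-term j ∘ lmulTerm 𝕩) P
    ≡⟨ cong₂ _++_ (sym (LP.map-concatMap (lmulTerm 𝕩) (τστ-term (suc j)) P))
         (trans (sym (LP.map-concatMap (lmulTerm 𝕪) (τστ-term j ∘ lmulTerm 𝕩) P)) (cong (lmul 𝕪) (sym (LP.concatMap-map (τστ-term j) (lmulTerm 𝕩) P)))) ⟩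
  lmul 𝕩 (τστ-poly (suc j) P) ++ lmul 𝕪 (τστ-poly j (lmul 𝕩 P)) ∎
  where open ≋-Reasoning

mulU : Series → Series
mulU S zero = []
mulU S (suc m) = S m

τστ : Series → Series
τστ P m = sumBelow (suc m) (λ i → τστ-poly (m ∸ i) (P i))

τστ-cong : ∀ {P Q} → (∀ i → P i ≡ Q i) → ∀ m → τστ P m ≡ τστ Q m
τστ-cong e m = sumBelow-cong (suc m) (λ i _ → cong (τστ-poly (m ∸ i)) (e i))

τστ-++ : ∀ P Q m → τστ (λ i → P i ++ Q i) m ≋ τστ P m ++ τστ Q m
τστ-++ P Q m = ≋-trans (≡⇒≋ (sumBelow-cong (suc m) (λ i _ → τστ-poly-++ (m ∸ i) (P i) (Q i))))
  (sumBelow-split (suc m) (λ i → τστ-poly (m ∸ i) (P i)) (λ i → τστ-poly (m ∸ i) (Q i)))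

τστ-lmul-y : ∀ P m → τστ (λ i → lmul 𝕪 (P i)) m ≡ lmul 𝕪 (τστ P m)
τστ-lmul-y P m = trans (sumBelow-cong (suc m) (λ i _ → τστ-poly-lmul-y (m ∸ i) (P i))) (sym (map-sumBelow (lmulTerm 𝕪) (suc m) (λ i → τστ-poly (m ∸ i) (P i))))

τστ-tmul : ∀ P m → τστ (λ i → tmul (P i)) m ≡ tmul (τστ P m)
τστ-tmul P m = trans (sumBelow-cong (suc m) (λ i _ → τστ-poly-tmul (m ∸ i) (P i))) (sym (map-sumBelow tmulTerm (suc m) (λ i → τστ-poly (m ∸ i) (P i))))

τστ-neg : ∀ P m → τστ (λ i → neg (P i)) m ≡ neg (τστ P m)
τστ-neg P m = trans (sumBelow-cong (suc m) (λ i _ → τστ-poly-neg (m ∸ i) (P i))) (sym (map-sumBelow negTerm (suc m) (λ i → τστ-poly (m ∸ i) (P i))))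

τστ-lmul-x-zero : ∀ P → τστ (λ i → lmul 𝕩 (P i)) 0 ≡ lmul 𝕩 (τστ P 0)
τστ-lmul-x-zero P = trans (cong (_++ []) (trans (τστ-poly-zero (lmul 𝕩 (P 0))) (cong (lmul 𝕩) (sym (τστ-poly-zero (P 0)))))) (sym (LP.map-++ (lmulTerm 𝕩) (τστ-poly 0 (P 0)) []))

τστ-lmul-x-suc : ∀ P m → τστ (λ i → lmul 𝕩 (P i)) (suc m) ≋ lmul 𝕩 (τστ P (suc m)) ++ lmul 𝕪 (τστ (λ i → lmul 𝕩 (P i)) m)
τστ-lmul-x-suc P m = begin
  sumBelow (suc (suc m)) L
    ≡⟨ sumBelow-suc (suc m) L ⟩
  sumBelow (suc m) L ++ L (suc m)
    ≈⟨ ++-cong (sumBelow-cong≋ (suc m) split) (≡⇒≋ last) ⟩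
  sumBelow (suc m) (λ i → R i ++ T i) ++ R (suc m)
    ≈⟨ ++-cong (sumBelow-split (suc m) R T) (≋-refl {R (suc m)}) ⟩
  (sumBelow (suc m) R ++ sumBelow (suc m) T) ++ R (suc m)
    ≈⟨ ++-swapʳ≋ (sumBelow (suc m) R) (sumBelow (suc m) T) (R (suc m)) ⟩
  (sumBelow (suc m) R ++ R (suc m)) ++ sumBelow (suc m) T
    ≡⟨ cong (_++ sumBelow (suc m) T) (sumBelow-suc (suc m) R) ⟨
  sumBelow (suc (suc m)) R ++ sumBelow (suc m) T
    ≡⟨ cong₂ _++_ (map-sumBelow (lmulTerm 𝕩) (suc (suc m)) (λ i → τστ-poly (suc m ∸ i) (P i)))
                  (map-sumBelow (lmulTerm 𝕪) (suc m) (λ i → τστ-poly (m ∸ i) (lmul 𝕩 (P i)))) ⟨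
  lmul 𝕩 (τστ P (suc m)) ++ lmul 𝕪 (τστ (λ i → lmul 𝕩 (P i)) m)
    ∎
  where
  open ≋-Reasoning
  L R T : ℕ → Poly
  L i = τστ-poly (suc m ∸ i) (lmul 𝕩 (P i))
  R i = lmul 𝕩 (τστ-poly (suc m ∸ i) (P i))
  T i = lmul 𝕪 (τστ-poly (m ∸ i) (lmul 𝕩 (P i)))
  split : ∀ i → i < suc m → L i ≋ R i ++ T i
  split i i≤m rewrite NP.+-∸-assoc 1 (NP.≤-pred i≤m) = τστ-poly-suc-lmul-x (m ∸ i) (P i)
  last : L (suc m) ≡ R (suc m)
  last rewrite NP.n∸n≡0 m = trans (τστ-poly-zero (lmul 𝕩 (P (suc m)))) (cong (lmul 𝕩) (sym (τστ-poly-zero (P (suc m)))))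

τ-σ-τ≡τστ : ∀ (F : Series) M → τ (σ (τ F)) M ≡ τστ F M
τ-σ-τ≡τστ F M = begin
  τ (σ (τ F)) M ≡⟨ LP.map-concatMap _ _ (upTo (suc M)) ⟩
  concatMap (λ m → map _ (concatMap _ (map _ (F m)))) (upTo (suc M))
    ≡⟨ LP.concatMap-cong (λ m → trans (LP.map-concatMap _ _ (map _ (F m))) (trans (LP.concatMap-map _ _ (F m)) (LP.concatMap-cong (λ t → inner M m t) (F m)))) (upTo (suc M)) ⟩
  concatMap (λ m → τστ-poly (M ∸ m) (F m)) (upTo (suc M)) ≡⟨ concatMap-upTo (λ m → τστ-poly (M ∸ m) (F m)) (suc M) ⟩
  τστ F M ∎
  where
  open ≡-Reasoning
  inner : ∀ M m t → _ ≡ τστ-term (M ∸ m) t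
  inner M m (c , n , w) = map-map _ _ (σw (M ∸ m) (τw w))

τστ-term-linear : ∀ j c n w → τστ-term j (c , n , w) ≋ scale c (τστ-term j (1ℚ , n , w))
τστ-term-linear j c n w = ≡⇒≋ (trans (LP.map-cong (λ v → cong (λ z → (z , n , τw v)) (sym (QP.*-identityʳ c))) (σw j (τw w)))
  (sym (map-map (scaleTerm c) (λ v → (1ℚ , n , τw v)) (σw j (τw w)))))

τστ-poly-cong≋ : ∀ j {P Q} → P ≋ Q → τστ-poly j P ≋ τστ-poly j Q
τστ-poly-cong≋ j = concatMap-linear-cong (τστ-term j) (τστ-term-linear j)

τστ-cong≋ : ∀ {P Q : Series} → (∀ i → P i ≋ Q i) → ∀ m → τστ P m ≋ τστ Q m
τστ-cong≋ e m = sumBelow-cong≋ (suc m) (λ i _ → τστ-poly-cong≋ (m ∸ i) (e i))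

-- Φ is the homomorphism x ↦ x, y ↦ y + t x: each later entry of an index is either kept after a comma
-- or added to its predecessor with a factor t.
Φ : Word → Poly
Φ [] = one
Φ (𝕩 ∷ v) = lmul 𝕩 (Φ v)
Φ (𝕪 ∷ v) = lmul 𝕪 (Φ v) ++ tmul (lmul 𝕩 (Φ v))

Φτστ : ℕ → Word → Poly
Φτστ j v = concatMap (Φ ∘ τw) (σw j (τw v))

Φ-snoc-𝕩 : ∀ L → concatMap (Φ ∘ τw ∘ (_++ [ 𝕩 ])) L ≋ lmul 𝕪 (concatMap (Φ ∘ τw) L) ++ tmul (lmul 𝕩 (concatMap (Φ ∘ τw) L))
Φ-snoc-𝕩 L = begin
  concatMap (Φ ∘ τw ∘ (_++ [ 𝕩 ])) L
    ≡⟨ LP.concatMap-cong (λ u → cong Φ (τw-snoc u 𝕩)) L ⟩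
  concatMap (λ u → lmul 𝕪 (Φ (τw u)) ++ tmul (lmul 𝕩 (Φ (τw u)))) L
    ≈⟨ concatMap-split (lmul 𝕪 ∘ Φ ∘ τw) (tmul ∘ lmul 𝕩 ∘ Φ ∘ τw) L ⟩
  concatMap (lmul 𝕪 ∘ Φ ∘ τw) L ++ concatMap (tmul ∘ lmul 𝕩 ∘ Φ ∘ τw) L
    ≡⟨ cong₂ _++_ (LP.map-concatMap (lmulTerm 𝕪) (Φ ∘ τw) L)
                  (trans (cong tmul (LP.map-concatMap (lmulTerm 𝕩) (Φ ∘ τw) L)) (LP.map-concatMap tmulTerm (lmul 𝕩 ∘ Φ ∘ τw) L)) ⟨
  lmul 𝕪 (concatMap (Φ ∘ τw) L) ++ tmul (lmul 𝕩 (concatMap (Φ ∘ τw) L))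
    ∎
  where open ≋-Reasoning

Φτστ-zero : ∀ v → Φτστ 0 v ≋ Φ v
Φτστ-zero v = begin
  concatMap (Φ ∘ τw) (σw 0 (τw v))  ≡⟨ cong (concatMap (Φ ∘ τw)) (σw-zero (τw v)) ⟩
  Φ (τw (τw v)) ++ []               ≡⟨ cong (λ u → Φ u ++ []) (τw-involutive v) ⟩
  Φ v ++ []                         ≈⟨ ++-identityʳ≋ (Φ v) ⟩
  Φ v                               ∎
  where open ≋-Reasoning

Φτστ-y : ∀ j v → Φτστ j (𝕪 ∷ v) ≋ lmul 𝕪 (Φτστ j v) ++ tmul (lmul 𝕩 (Φτστ j v))
Φτστ-y j v = begin
  concatMap (Φ ∘ τw) (σw j (τw (𝕪 ∷ v)))           ≡⟨ cong (λ u → concatMap (Φ ∘ τw) (σw j u)) (τw-∷ 𝕪 v) ⟩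
  concatMap (Φ ∘ τw) (σw j (τw v ++ [ 𝕩 ]))         ≡⟨ cong (concatMap (Φ ∘ τw)) (σw-snoc-x (τw v) j) ⟩
  concatMap (Φ ∘ τw) (map (_++ [ 𝕩 ]) (σw j (τw v))) ≡⟨ LP.concatMap-map (Φ ∘ τw) (_++ [ 𝕩 ]) (σw j (τw v)) ⟩
  concatMap (Φ ∘ τw ∘ (_++ [ 𝕩 ])) (σw j (τw v))     ≈⟨ Φ-snoc-𝕩 (σw j (τw v)) ⟩
  lmul 𝕪 (Φτστ j v) ++ tmul (lmul 𝕩 (Φτστ j v))    ∎
  where open ≋-Reasoning

Φτστ-suc-x : ∀ j v → Φτστ (suc j) (𝕩 ∷ v) ≋ lmul 𝕩 (Φτστ (suc j) v) ++ (lmul 𝕪 (Φτστ j (𝕩 ∷ v)) ++ tmul (lmul 𝕩 (Φτστ j (𝕩 ∷ v))))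
Φτστ-suc-x j v = begin
  concatMap (Φ ∘ τw) (σw (suc j) (τw (𝕩 ∷ v)))
    ≡⟨ cong (λ u → concatMap (Φ ∘ τw) (σw (suc j) u)) (τw-∷ 𝕩 v) ⟩
  concatMap (Φ ∘ τw) (σw (suc j) (τw v ++ [ 𝕪 ]))
    ≈⟨ concatMap-σw-suc-snoc-y (τw v) (Φ ∘ τw) j ⟩
  concatMap (Φ ∘ τw ∘ (_++ [ 𝕪 ])) (σw (suc j) (τw v)) ++ concatMap (Φ ∘ τw ∘ (_++ [ 𝕩 ])) (σw j (τw v ++ [ 𝕪 ]))
    ≡⟨ cong (λ u → concatMap (Φ ∘ τw ∘ (_++ [ 𝕪 ])) (σw (suc j) (τw v)) ++ concatMap (Φ ∘ τw ∘ (_++ [ 𝕩 ])) (σw j u)) (τw-∷ 𝕩 v) ⟨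
  concatMap (Φ ∘ τw ∘ (_++ [ 𝕪 ])) (σw (suc j) (τw v)) ++ concatMap (Φ ∘ τw ∘ (_++ [ 𝕩 ])) (σw j (τw (𝕩 ∷ v)))
    ≈⟨ ++-cong (≡⇒≋ (trans (LP.concatMap-cong (λ u → cong Φ (τw-snoc u 𝕪)) (σw (suc j) (τw v)))
                            (sym (LP.map-concatMap (lmulTerm 𝕩) (Φ ∘ τw) (σw (suc j) (τw v))))))
               (Φ-snoc-𝕩 (σw j (τw (𝕩 ∷ v)))) ⟩
  lmul 𝕩 (Φτστ (suc j) v) ++ (lmul 𝕪 (Φτστ j (𝕩 ∷ v)) ++ tmul (lmul 𝕩 (Φτστ j (𝕩 ∷ v))))
    ∎
  where open ≋-Reasoning

-- Left multiplication by x′ = x(1 − xtu)⁻¹, through x′ = x + x t u x′, and by y′ = y(1 − xtu) + x t;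
-- substitute is the homomorphism ρ : x ↦ x′, y ↦ y′.
mulX′ : Series → Series
mulX′ S zero = lmul 𝕩 (S zero)
mulX′ S (suc i) = lmul 𝕩 (S (suc i) ++ tmul (mulX′ S i))

mulX′-unfold : ∀ S i → mulX′ S i ≡ lmul 𝕩 (S i ++ tmul (mulU (mulX′ S) i))
mulX′-unfold S zero = cong (lmul 𝕩) (sym (LP.++-identityʳ (S zero)))
mulX′-unfold S (suc i) = refl

mulY′ : Series → Series
mulY′ S i = lmul 𝕪 (S i) ++ (tmul (lmul 𝕩 (S i)) ++ neg (tmul (lmul 𝕪 (lmul 𝕩 (mulU S i)))))

substitute : Word → Series
substitute [] zero = one
substitute [] (suc _) = []
substitute (𝕩 ∷ v) = mulX′ (substitute v)
substitute (𝕪 ∷ v) = mulY′ (substitute v)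

-- The term −t y x u of y′ cancels the shift in u that τστ produces from x.
τστ-mulY′ : ∀ S m → τστ (mulY′ S) m ≋ lmul 𝕪 (τστ S m) ++ tmul (lmul 𝕩 (τστ S m))
τστ-mulY′ S m = begin
  τστ (mulY′ S) m
    ≈⟨ τστ-++ (lmul 𝕪 ∘ S) (λ i → tmul (lmul 𝕩 (S i)) ++ neg (tmul (lmul 𝕪 (XS′ i)))) m ⟩
  τστ (lmul 𝕪 ∘ S) m ++ τστ (λ i → tmul (lmul 𝕩 (S i)) ++ neg (tmul (lmul 𝕪 (XS′ i)))) m
    ≈⟨ ++-cong (≋-refl {τστ (lmul 𝕪 ∘ S) m}) (τστ-++ (λ i → tmul (lmul 𝕩 (S i))) (λ i → neg (tmul (lmul 𝕪 (XS′ i)))) m) ⟩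
  τστ (lmul 𝕪 ∘ S) m ++ (τστ (λ i → tmul (XS i)) m ++ τστ (λ i → neg (tmul (lmul 𝕪 (XS′ i)))) m)
    ≡⟨ cong₂ _++_ (τστ-lmul-y S m) (cong₂ _++_ (τστ-tmul XS m)
         (trans (τστ-neg (λ i → tmul (lmul 𝕪 (XS′ i))) m) (cong neg (trans (τστ-tmul (λ i → lmul 𝕪 (XS′ i)) m) (cong tmul (τστ-lmul-y XS′ m)))))) ⟩
  lmul 𝕪 (τστ S m) ++ (tmul (τστ XS m) ++ neg (tmul (lmul 𝕪 (τστ XS′ m))))
    ≈⟨ ++-cong (≋-refl {lmul 𝕪 (τστ S m)}) (tail m) ⟩
  lmul 𝕪 (τστ S m) ++ tmul (lmul 𝕩 (τστ S m))
    ∎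
  where
  open ≋-Reasoning
  XS XS′ : Series
  XS i = lmul 𝕩 (S i)
  XS′ i = lmul 𝕩 (mulU S i)
  tail : ∀ m → tmul (τστ XS m) ++ neg (tmul (lmul 𝕪 (τστ XS′ m))) ≋ tmul (lmul 𝕩 (τστ S m))
  tail zero = ≋-trans (++-identityʳ≋ (tmul (τστ XS 0))) (≡⇒≋ (cong tmul (τστ-lmul-x-zero S)))
  tail (suc m) = begin
    tmul (τστ XS (suc m)) ++ neg (tmul (lmul 𝕪 (τστ XS′ (suc m))))
      ≡⟨ cong (λ P → tmul (τστ XS (suc m)) ++ neg (tmul (lmul 𝕪 P))) (τστ-cong mulU-lmul (suc m)) ⟩
    tmul (τστ XS (suc m)) ++ neg (tmul (lmul 𝕪 (τστ XS m)))
      ≈⟨ ++-cong (tmul-cong (τστ-lmul-x-suc S m)) ≋-refl ⟩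
    tmul (lmul 𝕩 (τστ S (suc m)) ++ lmul 𝕪 (τστ XS m)) ++ neg (tmul (lmul 𝕪 (τστ XS m)))
      ≡⟨ cong (_++ neg (tmul (lmul 𝕪 (τστ XS m)))) (LP.map-++ tmulTerm (lmul 𝕩 (τστ S (suc m))) (lmul 𝕪 (τστ XS m))) ⟩
    (tmul (lmul 𝕩 (τστ S (suc m))) ++ tmul (lmul 𝕪 (τστ XS m))) ++ neg (tmul (lmul 𝕪 (τστ XS m)))
      ≈⟨ ++-neg-cancel (tmul (lmul 𝕩 (τστ S (suc m)))) (tmul (lmul 𝕪 (τστ XS m))) ⟩
    tmul (lmul 𝕩 (τστ S (suc m)))
      ∎
    where
    mulU-lmul : ∀ i → XS′ i ≡ mulU XS i
    mulU-lmul zero = refl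
    mulU-lmul (suc i) = refl

τστ-mulX′-zero : ∀ S → τστ (mulX′ S) 0 ≋ lmul 𝕩 (τστ S 0)
τστ-mulX′-zero S = begin
  τστ (mulX′ S) 0                                    ≡⟨ trans (τστ-cong (mulX′-unfold S) 0) (τστ-lmul-x-zero T) ⟩
  lmul 𝕩 (τστ T 0)                                   ≈⟨ lmul-cong 𝕩 (τστ-++ S (λ i → tmul (mulU (mulX′ S) i)) 0) ⟩
  lmul 𝕩 (τστ S 0 ++ [])                             ≈⟨ lmul-cong 𝕩 (++-identityʳ≋ (τστ S 0)) ⟩
  lmul 𝕩 (τστ S 0)                                   ∎
  where
  open ≋-Reasoning
  T : Series
  T i = S i ++ tmul (mulU (mulX′ S) i)

τστ-mulX′-suc : ∀ S m → τστ (mulX′ S) (suc m) ≋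
  lmul 𝕩 (τστ S (suc m)) ++ (lmul 𝕪 (τστ (mulX′ S) m) ++ tmul (lmul 𝕩 (τστ (mulX′ S) m)))
τστ-mulX′-suc S m = begin
  τστ (mulX′ S) (suc m)
    ≡⟨ τστ-cong (mulX′-unfold S) (suc m) ⟩
  τστ (lmul 𝕩 ∘ T) (suc m)
    ≈⟨ τστ-lmul-x-suc T m ⟩
  lmul 𝕩 (τστ T (suc m)) ++ lmul 𝕪 (τστ (lmul 𝕩 ∘ T) m)
    ≡⟨ cong (λ P → lmul 𝕩 (τστ T (suc m)) ++ lmul 𝕪 P) (τστ-cong (mulX′-unfold S) m) ⟨
  lmul 𝕩 (τστ T (suc m)) ++ lmul 𝕪 (C m)
    ≈⟨ ++-cong (lmul-cong 𝕩 (τστ-++ S (λ i → tmul (mulU (mulX′ S) i)) (suc m))) (≋-refl {lmul 𝕪 (C m)}) ⟩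
  lmul 𝕩 (τστ S (suc m) ++ τστ (λ i → tmul (mulU (mulX′ S) i)) (suc m)) ++ lmul 𝕪 (C m)
    ≡⟨ cong (λ P → lmul 𝕩 (τστ S (suc m) ++ P) ++ lmul 𝕪 (C m)) (τστ-tmul (mulU (mulX′ S)) (suc m)) ⟩
  lmul 𝕩 (τστ S (suc m) ++ tmul (C m)) ++ lmul 𝕪 (C m)
    ≡⟨ cong (_++ lmul 𝕪 (C m)) (trans (LP.map-++ (lmulTerm 𝕩) (τστ S (suc m)) (tmul (C m))) (cong (lmul 𝕩 (τστ S (suc m)) ++_) (lmul-tmul 𝕩 (C m)))) ⟩
  (lmul 𝕩 (τστ S (suc m)) ++ tmul (lmul 𝕩 (C m))) ++ lmul 𝕪 (C m)
    ≈⟨ ++-swapʳ≋ [] (lmul 𝕩 (τστ S (suc m)) ++ tmul (lmul 𝕩 (C m))) (lmul 𝕪 (C m)) ⟩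
  lmul 𝕪 (C m) ++ (lmul 𝕩 (τστ S (suc m)) ++ tmul (lmul 𝕩 (C m)))
    ≈⟨ ++-interchange≋ [] (lmul 𝕪 (C m)) (lmul 𝕩 (τστ S (suc m))) (tmul (lmul 𝕩 (C m))) ⟩
  lmul 𝕩 (τστ S (suc m)) ++ (lmul 𝕪 (C m) ++ tmul (lmul 𝕩 (C m)))
    ∎
  where
  open ≋-Reasoning
  T : Series
  T i = S i ++ tmul (mulU (mulX′ S) i)
  C : Series
  C = τστ (mulX′ S)

Φτστ≋τστ-substitute : ∀ v m → Φτστ m v ≋ τστ (substitute v) m
Φτστ≋τστ-substitute [] zero = ≡⇒≋ (cong (_++ []) (sym (τστ-poly-zero one)))
Φτστ≋τστ-substitute [] (suc m) = ≋-sym (sumBelow-zero (suc (suc m)) vanish)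
  where
  vanish : ∀ i → i < suc (suc m) → τστ-poly (suc m ∸ i) (substitute [] i) ≋ []
  vanish zero _ = ≋-refl
  vanish (suc i) _ = ≋-refl
Φτστ≋τστ-substitute (𝕪 ∷ v) m = begin
  Φτστ m (𝕪 ∷ v)                                 ≈⟨ Φτστ-y m v ⟩
  lmul 𝕪 (Φτστ m v) ++ tmul (lmul 𝕩 (Φτστ m v))  ≈⟨ ++-cong (lmul-cong 𝕪 IH) (tmul-cong (lmul-cong 𝕩 IH)) ⟩
  lmul 𝕪 (R m) ++ tmul (lmul 𝕩 (R m))            ≈⟨ τστ-mulY′ (substitute v) m ⟨
  τστ (substitute (𝕪 ∷ v)) m                     ∎
  where
  open ≋-Reasoning
  R = τστ (substitute v)
  IH = Φτστ≋τστ-substitute v m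
Φτστ≋τστ-substitute (𝕩 ∷ v) zero = begin
  Φτστ 0 (𝕩 ∷ v)                 ≈⟨ Φτστ-zero (𝕩 ∷ v) ⟩
  lmul 𝕩 (Φ v)                   ≈⟨ lmul-cong 𝕩 (Φτστ-zero v) ⟨
  lmul 𝕩 (Φτστ 0 v)              ≈⟨ lmul-cong 𝕩 (Φτστ≋τστ-substitute v 0) ⟩
  lmul 𝕩 (τστ (substitute v) 0)  ≈⟨ τστ-mulX′-zero (substitute v) ⟨
  τστ (substitute (𝕩 ∷ v)) 0     ∎
  where open ≋-Reasoning
Φτστ≋τστ-substitute (𝕩 ∷ v) (suc m) = begin
  Φτστ (suc m) (𝕩 ∷ v)
    ≈⟨ Φτστ-suc-x m v ⟩
  lmul 𝕩 (Φτστ (suc m) v) ++ (lmul 𝕪 (Φτστ m (𝕩 ∷ v)) ++ tmul (lmul 𝕩 (Φτστ m (𝕩 ∷ v))))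
    ≈⟨ ++-cong (lmul-cong 𝕩 (Φτστ≋τστ-substitute v (suc m))) (++-cong (lmul-cong 𝕪 IH) (tmul-cong (lmul-cong 𝕩 IH))) ⟩
  lmul 𝕩 (τστ (substitute v) (suc m)) ++ (lmul 𝕪 (C m) ++ tmul (lmul 𝕩 (C m)))
    ≈⟨ τστ-mulX′-suc (substitute v) m ⟨
  τστ (substitute (𝕩 ∷ v)) (suc m)
    ∎
  where
  open ≋-Reasoning
  C = τστ (substitute (𝕩 ∷ v))
  IH = Φτστ≋τστ-substitute (𝕩 ∷ v) m

-- The left-hand side

lmul𝕩^ : ℕ → Poly → Poly
lmul𝕩^ zero P = P
lmul𝕩^ (suc k) P = lmul 𝕩 (lmul𝕩^ k P)

Φ-𝕩^ : ∀ k v → Φ (𝕩^ k ++ v) ≡ lmul𝕩^ k (Φ v)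
Φ-𝕩^ zero v = refl
Φ-𝕩^ (suc k) v = cong (lmul 𝕩) (Φ-𝕩^ k v)

lmul𝕩^-++ : ∀ k P Q → lmul𝕩^ k (P ++ Q) ≡ lmul𝕩^ k P ++ lmul𝕩^ k Q
lmul𝕩^-++ zero P Q = refl
lmul𝕩^-++ (suc k) P Q = trans (cong (lmul 𝕩) (lmul𝕩^-++ k P Q)) (LP.map-++ (lmulTerm 𝕩) (lmul𝕩^ k P) (lmul𝕩^ k Q))

lmul𝕩^-tmul : ∀ k P → lmul𝕩^ k (tmul P) ≡ tmul (lmul𝕩^ k P)
lmul𝕩^-tmul zero P = refl
lmul𝕩^-tmul (suc k) P = trans (cong (lmul 𝕩) (lmul𝕩^-tmul k P)) (lmul-tmul 𝕩 (lmul𝕩^ k P))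

lmul𝕩^-+ : ∀ a b P → lmul𝕩^ a (lmul𝕩^ b P) ≡ lmul𝕩^ (a + b) P
lmul𝕩^-+ zero b P = refl
lmul𝕩^-+ (suc a) b P = cong (lmul 𝕩) (lmul𝕩^-+ a b P)

lmul𝕩^-cong : ∀ k {P Q} → P ≋ Q → lmul𝕩^ k P ≋ lmul𝕩^ k Q
lmul𝕩^-cong zero e = e
lmul𝕩^-cong (suc k) e = lmul-cong 𝕩 (lmul𝕩^-cong k e)

lmulWordTerm : Word → Term → Term
lmulWordTerm u (c , n , w) = (c , n , u ++ w)

lmulWord : Word → Poly → Poly
lmulWord u = map (lmulWordTerm u)

lmulWord-∷ : ∀ a u P → lmulWord (a ∷ u) P ≡ lmul a (lmulWord u P)
lmulWord-∷ a u P = sym (map-map (lmulTerm a) (lmulWordTerm u) P)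

lmulWord-[] : ∀ P → lmulWord [] P ≡ P
lmulWord-[] P = LP.map-id P

lmulWord-cong : ∀ u {P Q} → P ≋ Q → lmulWord u P ≋ lmulWord u Q
lmulWord-cong [] {P} {Q} e = ≋-trans (≡⇒≋ (lmulWord-[] P)) (≋-trans e (≡⇒≋ (sym (lmulWord-[] Q))))
lmulWord-cong (a ∷ u) {P} {Q} e = ≋-trans (≡⇒≋ (lmulWord-∷ a u P)) (≋-trans (lmul-cong a (lmulWord-cong u e)) (≡⇒≋ (sym (lmulWord-∷ a u Q))))

lmulWord-𝕩^ : ∀ k P → lmulWord (𝕩^ k) P ≡ lmul𝕩^ k P
lmulWord-𝕩^ zero P = lmulWord-[] P
lmulWord-𝕩^ (suc k) P = trans (lmulWord-∷ 𝕩 (𝕩^ k) P) (cong (lmul 𝕩) (lmulWord-𝕩^ k P))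

indexTerm : ℕ × Index → Term
indexTerm (n , i) = (1ℚ , n , idxWord i)

It-Igo : ∀ bs a → 1 ≤ a → All (1 ≤_) bs → map indexTerm (Igo a bs) ≋ lmul 𝕪 (lmul𝕩^ (a ∸ 1) (Φ (idxWord bs)))
It-Igo [] a a≥1 _ = ≡⇒≋ (cong (lmul 𝕪) (trans (cong (λ u → (1ℚ , 0 , u) ∷ []) (LP.++-identityʳ (𝕩^ (a ∸ 1)))) (sym (lmul𝕩^-one (a ∸ 1)))))
  where
  lmul𝕩^-one : ∀ k → lmul𝕩^ k one ≡ (1ℚ , 0 , 𝕩^ k) ∷ []
  lmul𝕩^-one zero = refl
  lmul𝕩^-one (suc k) = cong (lmul 𝕩) (lmul𝕩^-one k)
It-Igo (b ∷ bs) a a≥1 (b≥1 ∷ pbs) = begin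
  map indexTerm (map prependHead (Igo b bs) ++ map mergeHead (Igo (a + b) bs)) ≡⟨ LP.map-++ indexTerm (map prependHead (Igo b bs)) _ ⟩
  map indexTerm (map prependHead (Igo b bs)) ++ map indexTerm (map mergeHead (Igo (a + b) bs))
    ≡⟨ cong₂ _++_ (trans (map-map indexTerm prependHead (Igo b bs)) (sym (map-map (lmulWordTerm (𝕪 ∷ 𝕩^ (a ∸ 1))) indexTerm (Igo b bs))))
                  (trans (map-map indexTerm mergeHead _) (sym (map-map tmulTerm indexTerm (Igo (a + b) bs)))) ⟩
  lmulWord (𝕪 ∷ 𝕩^ (a ∸ 1)) (map indexTerm (Igo b bs)) ++ tmul (map indexTerm (Igo (a + b) bs))
    ≈⟨ ++-cong (lmulWord-cong (𝕪 ∷ 𝕩^ (a ∸ 1)) (It-Igo bs b b≥1 pbs)) (tmul-cong (It-Igo bs (a + b) (NP.≤-trans a≥1 (NP.m≤m+n a b)) pbs)) ⟩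
  lmulWord (𝕪 ∷ 𝕩^ (a ∸ 1)) (lmul 𝕪 (lmul𝕩^ (b ∸ 1) V)) ++ tmul (lmul 𝕪 (lmul𝕩^ (a + b ∸ 1) V))
    ≡⟨ cong₂ _++_ (trans (lmulWord-∷ 𝕪 (𝕩^ (a ∸ 1)) _) (cong (lmul 𝕪) (lmulWord-𝕩^ (a ∸ 1) _)))
         (trans (cong (λ z → tmul (lmul 𝕪 (lmul𝕩^ z V))) exponent) (trans (cong (tmul ∘ lmul 𝕪) (sym (lmul𝕩^-+ (a ∸ 1) (suc (b ∸ 1)) V)))
           (trans (sym (lmul-tmul 𝕪 _)) (cong (lmul 𝕪) (sym (lmul𝕩^-tmul (a ∸ 1) _)))))) ⟩
  lmul 𝕪 (lmul𝕩^ (a ∸ 1) (lmul 𝕪 (lmul𝕩^ (b ∸ 1) V))) ++ lmul 𝕪 (lmul𝕩^ (a ∸ 1) (tmul (lmul 𝕩 (lmul𝕩^ (b ∸ 1) V))))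
    ≡⟨ trans (sym (LP.map-++ (lmulTerm 𝕪) (lmul𝕩^ (a ∸ 1) (lmul 𝕪 (lmul𝕩^ (b ∸ 1) V))) (lmul𝕩^ (a ∸ 1) (tmul (lmul 𝕩 (lmul𝕩^ (b ∸ 1) V))))))
         (cong (lmul 𝕪) (sym (lmul𝕩^-++ (a ∸ 1) (lmul 𝕪 (lmul𝕩^ (b ∸ 1) V)) (tmul (lmul 𝕩 (lmul𝕩^ (b ∸ 1) V)))))) ⟩
  lmul 𝕪 (lmul𝕩^ (a ∸ 1) (lmul 𝕪 (lmul𝕩^ (b ∸ 1) V) ++ tmul (lmul 𝕩 (lmul𝕩^ (b ∸ 1) V))))
    ≡⟨ cong (λ z → lmul 𝕪 (lmul𝕩^ (a ∸ 1) (lmul 𝕪 z ++ tmul (lmul 𝕩 z)))) (sym (Φ-𝕩^ (b ∸ 1) (idxWord bs))) ⟩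
  lmul 𝕪 (lmul𝕩^ (a ∸ 1) (Φ (idxWord (b ∷ bs)))) ∎
  where
  open ≋-Reasoning
  V : Poly
  V = Φ (idxWord bs)
  prependHead : ℕ × Index → ℕ × Index
  prependHead (n , i) = (n , a ∷ i)
  mergeHead : ℕ × Index → ℕ × Index
  mergeHead (n , i) = (suc n , i)
  exponent : a + b ∸ 1 ≡ (a ∸ 1) + suc (b ∸ 1)
  exponent = cong (_∸ 1) (cong₂ _+_ (sym (NP.suc-pred a {{ℕ.>-nonZero a≥1}})) (sym (NP.suc-pred b {{ℕ.>-nonZero b≥1}})))

-- I^t read on words; words not starting with y come from no index and get the junk value [].
Itw : Word → Poly
Itw [] = one
Itw (𝕪 ∷ v) = lmul 𝕪 (Φ v)
Itw (𝕩 ∷ v) = []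

It≋Itw : ∀ i → All (1 ≤_) i → It i ≋ Itw (idxWord i)
It≋Itw [] _ = ≋-refl
It≋Itw (a ∷ bs) (a≥1 ∷ pbs) = ≋-trans (It-Igo bs a a≥1 pbs) (≡⇒≋ (cong (lmul 𝕪) (sym (Φ-𝕩^ (a ∸ 1) (idxWord bs)))))

All-reverse : ∀ {A : Set} {P : A → Set} L → All P L → All P (reverse L)
All-reverse [] [] = []
All-reverse (x ∷ L) (p ∷ ps) = subst (All _) (sym (LP.unfold-reverse x L)) (AllP.++⁺ (All-reverse L ps) (p ∷ []))

block : ℕ × ℕ → Word
block (a , b) = replicate a 𝕪 ++ replicate b 𝕩

dualBlock : ℕ × ℕ → Word
dualBlock (a , b) = replicate b 𝕪 ++ replicate a 𝕩

idxWord-abPairs : ∀ ks n kr → 2 ≤ kr → All (1 ≤_) ks → replicate n 𝕪 ++ idxWord (ks ++ [ kr ]) ≡ concatMap block (abPairs n (ks ++ [ kr ]))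
idxWord-abPairs [] n (suc (suc k)) _ _ = trans (replicate-++-∷ n 𝕪 _) (cong (𝕪 ∷_) (sym (LP.++-assoc (replicate n 𝕪) (replicate (suc k) 𝕩) [])))
idxWord-abPairs [] n (suc zero) (s≤s ()) _
idxWord-abPairs (suc zero ∷ ks) n kr kr2 (_ ∷ pks) = trans (replicate-++-∷ n 𝕪 _) (idxWord-abPairs ks (suc n) kr kr2 pks)
idxWord-abPairs (suc (suc k) ∷ ks) n kr kr2 (_ ∷ pks) = trans (replicate-++-∷ n 𝕪 _)
  (cong (𝕪 ∷_) (trans (cong (λ z → replicate n 𝕪 ++ (replicate (suc k) 𝕩 ++ z)) (idxWord-abPairs ks 0 kr kr2 pks))
    (sym (LP.++-assoc (replicate n 𝕪) (replicate (suc k) 𝕩) _))))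

abPairs-positive : ∀ ks n kr → 2 ≤ kr → All (1 ≤_) ks → All (λ p → 1 ≤ proj₂ p) (abPairs n (ks ++ [ kr ]))
abPairs-positive [] n (suc (suc k)) _ _ = s≤s z≤n ∷ []
abPairs-positive [] n (suc zero) (s≤s ()) _
abPairs-positive (suc zero ∷ ks) n kr kr2 (_ ∷ pks) = abPairs-positive ks (suc n) kr kr2 pks
abPairs-positive (suc (suc k) ∷ ks) n kr kr2 (_ ∷ pks) = s≤s z≤n ∷ abPairs-positive ks 0 kr kr2 pks

abPairs-nonempty : ∀ ks n kr → 2 ≤ kr → All (1 ≤_) ks → Σ ℕ λ c → Σ ℕ λ b → Σ (List (ℕ × ℕ)) λ P → abPairs n (ks ++ [ kr ]) ≡ (suc c , b) ∷ P
abPairs-nonempty [] n (suc (suc k)) _ _ = n , suc k , [] , refl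
abPairs-nonempty [] n (suc zero) (s≤s ()) _
abPairs-nonempty (suc zero ∷ ks) n kr kr2 (_ ∷ pks) = abPairs-nonempty ks (suc n) kr kr2 pks
abPairs-nonempty (suc (suc k) ∷ ks) n kr kr2 (_ ∷ pks) = n , suc k , _ , refl

dualBlockIndex : ℕ × ℕ → Index
dualBlockIndex (a , b) = replicate (b ∸ 1) 1 ++ [ suc a ]

idxWord-++ : ∀ u v → idxWord (u ++ v) ≡ idxWord u ++ idxWord v
idxWord-++ u v = LP.concatMap-++ _ u v

idxWord-replicate-1 : ∀ n → idxWord (replicate n 1) ≡ replicate n 𝕪
idxWord-replicate-1 zero = refl
idxWord-replicate-1 (suc n) = cong (𝕪 ∷_) (idxWord-replicate-1 n)

idxWord-dualBlockIndex : ∀ p → 1 ≤ proj₂ p → idxWord (dualBlockIndex p) ≡ dualBlock p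
idxWord-dualBlockIndex (a , suc b) _ = trans (idxWord-++ (replicate b 1) [ suc a ])
  (trans (cong₂ _++_ (idxWord-replicate-1 b) (LP.++-identityʳ (𝕪 ∷ replicate a 𝕩))) (replicate-++-∷ b 𝕪 (replicate a 𝕩)))

τw-block : ∀ p → τw (block p) ≡ dualBlock p
τw-block (a , b) = trans (τw-++ (replicate a 𝕪) (replicate b 𝕩)) (cong₂ _++_ (τw-replicate b 𝕩) (τw-replicate a 𝕪))

τw-concatMap-block : ∀ P → τw (concatMap block P) ≡ concatMap dualBlock (reverse P)
τw-concatMap-block [] = refl
τw-concatMap-block (p ∷ P) = begin
  τw (block p ++ concatMap block P) ≡⟨ τw-++ (block p) (concatMap block P) ⟩
  τw (concatMap block P) ++ τw (block p) ≡⟨ cong₂ _++_ (τw-concatMap-block P) (τw-block p) ⟩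
  concatMap dualBlock (reverse P) ++ dualBlock p ≡⟨ cong (concatMap dualBlock (reverse P) ++_) (sym (LP.++-identityʳ (dualBlock p))) ⟩
  concatMap dualBlock (reverse P) ++ concatMap dualBlock [ p ] ≡⟨ sym (LP.concatMap-++ dualBlock (reverse P) [ p ]) ⟩
  concatMap dualBlock (reverse P ++ [ p ]) ≡⟨ cong (concatMap dualBlock) (sym (LP.unfold-reverse p P)) ⟩
  concatMap dualBlock (reverse (p ∷ P)) ∎
  where open ≡-Reasoning

idxWord-concatMap-dualBlockIndex : ∀ P → All (λ p → 1 ≤ proj₂ p) P → idxWord (concatMap dualBlockIndex P) ≡ concatMap dualBlock P
idxWord-concatMap-dualBlockIndex P ps = trans (concatMap-concatMap _ dualBlockIndex P) (cmcong P ps)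
  where
  cmcong : ∀ P → All (λ p → 1 ≤ proj₂ p) P → concatMap (idxWord ∘ dualBlockIndex) P ≡ concatMap dualBlock P
  cmcong [] [] = refl
  cmcong (p ∷ P) (q ∷ qs) = cong₂ _++_ (idxWord-dualBlockIndex p q) (cmcong P qs)

idxWord-dual : ∀ ks kr → 2 ≤ kr → All (1 ≤_) ks → idxWord (dual (ks ++ [ kr ])) ≡ τw (idxWord (ks ++ [ kr ]))
idxWord-dual ks kr kr2 pks = begin
  idxWord (concatMap dualBlockIndex (reverse P)) ≡⟨ idxWord-concatMap-dualBlockIndex (reverse P) (All-reverse P (abPairs-positive ks 0 kr kr2 pks)) ⟩
  concatMap dualBlock (reverse P) ≡⟨ sym (τw-concatMap-block P) ⟩
  τw (concatMap block P) ≡⟨ cong τw (sym (idxWord-abPairs ks 0 kr kr2 pks)) ⟩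
  τw (idxWord (ks ++ [ kr ])) ∎
  where open ≡-Reasoning
        P = abPairs 0 (ks ++ [ kr ])

All-concatMap : ∀ {A B : Set} {P : B → Set} (f : A → List B) → (∀ x → All P (f x)) → ∀ L → All P (concatMap f L)
All-concatMap f h L = AllP.concat⁺ (AllP.map⁺ (All.universal h L))

dualBlockIndex-positive : ∀ p → All (1 ≤_) (dualBlockIndex p)
dualBlockIndex-positive (a , b) = AllP.++⁺ (AllP.replicate⁺ (b ∸ 1) (s≤s z≤n)) (s≤s z≤n ∷ [])

PositiveAdmissible : Index → Set
PositiveAdmissible k = Σ Index λ ks → Σ ℕ λ kr → (k ≡ ks ++ [ kr ]) × 2 ≤ kr × All (1 ≤_) ks

dual-admissible : ∀ ks kr → 2 ≤ kr → All (1 ≤_) ks → PositiveAdmissible (dual (ks ++ [ kr ]))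
dual-admissible ks kr kr2 pks with abPairs-nonempty ks 0 kr kr2 pks
... | c , b , P' , eq =
  A ++ replicate (b ∸ 1) 1 , suc (suc c) ,
  trans (cong (λ z → concatMap dualBlockIndex (reverse z)) eq)
   (trans (cong (concatMap dualBlockIndex) (LP.unfold-reverse (suc c , b) P'))
   (trans (LP.concatMap-++ dualBlockIndex (reverse P') [ (suc c , b) ])
   (trans (cong (A ++_) (LP.++-identityʳ (dualBlockIndex (suc c , b)))) (sym (LP.++-assoc A (replicate (b ∸ 1) 1) _))))) ,
  s≤s (s≤s z≤n) ,
  AllP.++⁺ (All-concatMap dualBlockIndex dualBlockIndex-positive (reverse P')) (AllP.replicate⁺ (b ∸ 1) (s≤s z≤n))
  where A = concatMap dualBlockIndex (reverse P')

⊕-admissible : ∀ ks kr e → 2 ≤ kr → All (1 ≤_) ks → length e ≡ length (ks ++ [ kr ]) → PositiveAdmissible ((ks ++ [ kr ]) ⊕ e)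
⊕-admissible [] kr (e0 ∷ []) kr2 _ _ = [] , kr + e0 , refl , NP.≤-trans kr2 (NP.m≤m+n kr e0) , []
⊕-admissible (k ∷ ks) kr (e0 ∷ e) kr2 (k1 ∷ pks) le with ⊕-admissible ks kr e kr2 pks (NP.suc-injective le)
... | ks' , kr' , eq , kr'2 , pks' = (k + e0) ∷ ks' , kr' , cong ((k + e0) ∷_) eq , kr'2 , NP.≤-trans k1 (NP.m≤m+n k e0) ∷ pks'

comps-suc : ∀ m d → comps m (suc d) ≡ concatMap (λ i → map (i ∷_) (comps (m ∸ i) d)) (upTo (suc m))
comps-suc zero d = refl
comps-suc (suc m) d = refl

comps-length : ∀ d m → All (λ e → length e ≡ d) (comps m d)
comps-length zero zero = refl ∷ []
comps-length zero (suc m) = []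
comps-length (suc d) m = subst (All (λ e → length e ≡ suc d)) (sym (comps-suc m d))
  (All-concatMap (λ i → map (i ∷_) (comps (m ∸ i) d)) (λ i → AllP.map⁺ (All.map (cong suc) (comps-length d (m ∸ i)))) (upTo (suc m)))

σw-𝕩^ : ∀ k j w → σw j (𝕩^ k ++ w) ≡ map (𝕩^ k ++_) (σw j w)
σw-𝕩^ zero j w = sym (LP.map-id (σw j w))
σw-𝕩^ (suc k) j w = trans (σw-x j (𝕩^ k ++ w)) (trans (cong (map (𝕩 ∷_)) (σw-𝕩^ k j w)) (map-map (𝕩 ∷_) (𝕩^ k ++_) (σw j w)))

𝕩^-+ : ∀ i k → 𝕩^ i ++ 𝕩^ k ≡ 𝕩^ (i + k)
𝕩^-+ zero k = refl
𝕩^-+ (suc i) k = cong (𝕩 ∷_) (𝕩^-+ i k)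

-- Adding e to the entries of c puts x^(e_i) behind the i-th y, which is how σ expands the u^m part.
idxWord-⊕-comps : ∀ c → All (1 ≤_) c → ∀ m → map (idxWord ∘ (c ⊕_)) (comps m (length c)) ≡ σw m (idxWord c)
idxWord-⊕-comps [] _ zero = refl
idxWord-⊕-comps [] _ (suc m) = refl
idxWord-⊕-comps (a ∷ c) (a≥1 ∷ pc) m = begin
  map (idxWord ∘ ((a ∷ c) ⊕_)) (comps m (suc (length c)))
    ≡⟨ cong (map (idxWord ∘ ((a ∷ c) ⊕_))) (comps-suc m (length c)) ⟩
  map (idxWord ∘ ((a ∷ c) ⊕_)) (concatMap (λ i → map (i ∷_) (E i)) (upTo (suc m)))
    ≡⟨ LP.map-concatMap (idxWord ∘ ((a ∷ c) ⊕_)) (λ i → map (i ∷_) (E i)) (upTo (suc m)) ⟩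
  concatMap (λ i → map (idxWord ∘ ((a ∷ c) ⊕_)) (map (i ∷_) (E i))) (upTo (suc m))
    ≡⟨ LP.concatMap-cong shifted (upTo (suc m)) ⟩
  concatMap (λ i → map (y𝕩^ i) (σw (m ∸ i) (𝕩^ (a ∸ 1) ++ idxWord c))) (upTo (suc m))
    ≡⟨ σw-y m (𝕩^ (a ∸ 1) ++ idxWord c) ⟨
  σw m (idxWord (a ∷ c))
    ∎
  where
  open ≡-Reasoning
  E : ℕ → List (List ℕ)
  E i = comps (m ∸ i) (length c)
  split-head : ∀ i v → 𝕪 ∷ 𝕩^ (a + i ∸ 1) ++ v ≡ y𝕩^ i (𝕩^ (a ∸ 1) ++ v)
  split-head i v = cong (𝕪 ∷_) (begin
    𝕩^ (a + i ∸ 1) ++ v         ≡⟨ cong (λ n → 𝕩^ n ++ v) (trans (NP.+-∸-comm i a≥1) (NP.+-comm (a ∸ 1) i)) ⟩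
    𝕩^ (i + (a ∸ 1)) ++ v       ≡⟨ cong (_++ v) (𝕩^-+ i (a ∸ 1)) ⟨
    (𝕩^ i ++ 𝕩^ (a ∸ 1)) ++ v   ≡⟨ LP.++-assoc (𝕩^ i) (𝕩^ (a ∸ 1)) v ⟩
    𝕩^ i ++ 𝕩^ (a ∸ 1) ++ v     ∎)
  shifted : ∀ i → map (idxWord ∘ ((a ∷ c) ⊕_)) (map (i ∷_) (E i)) ≡ map (y𝕩^ i) (σw (m ∸ i) (𝕩^ (a ∸ 1) ++ idxWord c))
  shifted i = begin
    map (idxWord ∘ ((a ∷ c) ⊕_)) (map (i ∷_) (E i))
      ≡⟨ map-map (idxWord ∘ ((a ∷ c) ⊕_)) (i ∷_) (E i) ⟩
    map (λ e → 𝕪 ∷ 𝕩^ (a + i ∸ 1) ++ idxWord (c ⊕ e)) (E i)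
      ≡⟨ LP.map-cong (λ e → split-head i (idxWord (c ⊕ e))) (E i) ⟩
    map (y𝕩^ i ∘ (𝕩^ (a ∸ 1) ++_) ∘ idxWord ∘ (c ⊕_)) (E i)
      ≡⟨ map-map (y𝕩^ i ∘ (𝕩^ (a ∸ 1) ++_)) (idxWord ∘ (c ⊕_)) (E i) ⟨
    map (y𝕩^ i ∘ (𝕩^ (a ∸ 1) ++_)) (map (idxWord ∘ (c ⊕_)) (E i))
      ≡⟨ cong (map (y𝕩^ i ∘ (𝕩^ (a ∸ 1) ++_))) (idxWord-⊕-comps c pc (m ∸ i)) ⟩
    map (y𝕩^ i ∘ (𝕩^ (a ∸ 1) ++_)) (σw (m ∸ i) (idxWord c))
      ≡⟨ map-map (y𝕩^ i) (𝕩^ (a ∸ 1) ++_) (σw (m ∸ i) (idxWord c)) ⟨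
    map (y𝕩^ i) (map (𝕩^ (a ∸ 1) ++_) (σw (m ∸ i) (idxWord c)))
      ≡⟨ cong (map (y𝕩^ i)) (σw-𝕩^ (a ∸ 1) (m ∸ i) (idxWord c)) ⟨
    map (y𝕩^ i) (σw (m ∸ i) (𝕩^ (a ∸ 1) ++ idxWord c))
      ∎

admissible-positive : ∀ ks kr → 2 ≤ kr → All (1 ≤_) ks → All (1 ≤_) (ks ++ [ kr ])
admissible-positive ks kr kr2 pks = AllP.++⁺ pks (NP.≤-trans (s≤s z≤n) kr2 ∷ [])

It-dual≋ : ∀ ks kr → 2 ≤ kr → All (1 ≤_) ks → It (dual (ks ++ [ kr ])) ≋ Itw (τw (idxWord (ks ++ [ kr ])))
It-dual≋ ks kr kr2 pks with dual-admissible ks kr kr2 pks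
... | ks' , kr' , eq , kr'2 , pks' =
  ≋-trans (It≋Itw (dual (ks ++ [ kr ])) (subst (All (1 ≤_)) (sym eq) (admissible-positive ks' kr' kr'2 pks')))
    (≡⇒≋ (cong Itw (idxWord-dual ks kr kr2 pks)))

LHS≋Itw-σw : ∀ ks kr → 2 ≤ kr → All (1 ≤_) ks → ∀ m →
  LHS (ks ++ [ kr ]) m ≋ concatMap (Itw ∘ τw) (σw m (τw (idxWord (ks ++ [ kr ]))))
LHS≋Itw-σw ks kr kr2 pks m with dual-admissible ks kr kr2 pks
... | ks' , kr' , eq , kr'2 , pks' = begin
  concatMap (λ e → It (dual (dk ⊕ e))) (comps m (dep dk)) ≈⟨ concatMap-cong≋-All (All.map step (comps-length (dep dk) m)) ⟩
  concatMap (λ e → Itw (τw (idxWord (dk ⊕ e)))) (comps m (dep dk)) ≡⟨ sym (LP.concatMap-map (Itw ∘ τw) (idxWord ∘ (dk ⊕_)) (comps m (dep dk))) ⟩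
  concatMap (Itw ∘ τw) (map (idxWord ∘ (dk ⊕_)) (comps m (length dk))) ≡⟨ cong (concatMap (Itw ∘ τw)) (idxWord-⊕-comps dk dkpos m) ⟩
  concatMap (Itw ∘ τw) (σw m (idxWord dk)) ≡⟨ cong (λ z → concatMap (Itw ∘ τw) (σw m z)) (idxWord-dual ks kr kr2 pks) ⟩
  concatMap (Itw ∘ τw) (σw m (τw (idxWord (ks ++ [ kr ])))) ∎
  where
  open ≋-Reasoning
  dk = dual (ks ++ [ kr ])
  dkpos : All (1 ≤_) dk
  dkpos = subst (All (1 ≤_)) (sym eq) (admissible-positive ks' kr' kr'2 pks')
  step : ∀ {e} → length e ≡ dep dk → It (dual (dk ⊕ e)) ≋ Itw (τw (idxWord (dk ⊕ e)))
  step {e} le with ⊕-admissible ks' kr' e kr'2 pks' (trans le (cong length eq))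
  ... | ks'' , kr'' , eq2 , kr''2 , pks'' =
    subst (λ z → It (dual z) ≋ Itw (τw (idxWord z))) (sym (trans (cong (_⊕ e) eq) eq2)) (It-dual≋ ks'' kr'' kr''2 pks'')

Itw-σw-y : ∀ k1 k' m → concatMap (Itw ∘ τw) (σw m (τw (idxWord (k1 ∷ k')))) ≡ lmul 𝕪 (Φτστ m (𝕩^ (k1 ∸ 1) ++ idxWord k'))
Itw-σw-y k1 k' m = begin
  concatMap (Itw ∘ τw) (σw m (τw (𝕪 ∷ w0))) ≡⟨ cong (λ z → concatMap (Itw ∘ τw) (σw m z)) (τw-∷ 𝕪 w0) ⟩
  concatMap (Itw ∘ τw) (σw m (τw w0 ++ [ 𝕩 ])) ≡⟨ cong (concatMap (Itw ∘ τw)) (σw-snoc-x (τw w0) m) ⟩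
  concatMap (Itw ∘ τw) (map (_++ [ 𝕩 ]) (σw m (τw w0))) ≡⟨ LP.concatMap-map (Itw ∘ τw) (_++ [ 𝕩 ]) (σw m (τw w0)) ⟩
  concatMap (Itw ∘ τw ∘ (_++ [ 𝕩 ])) (σw m (τw w0)) ≡⟨ LP.concatMap-cong (λ u → cong Itw (τw-snoc u 𝕩)) (σw m (τw w0)) ⟩
  concatMap (lmul 𝕪 ∘ Φ ∘ τw) (σw m (τw w0)) ≡⟨ sym (LP.map-concatMap (lmulTerm 𝕪) (Φ ∘ τw) (σw m (τw w0))) ⟩
  lmul 𝕪 (Φτστ m w0) ∎
  where
  open ≡-Reasoning
  w0 = 𝕩^ (k1 ∸ 1) ++ idxWord k'

LHS≋Φτστ : ∀ k₁ k′ → All (1 ≤_) (k₁ ∷ k′) → Admissible (k₁ ∷ k′) → ∀ m →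
  LHS (k₁ ∷ k′) m ≋ lmul 𝕪 (Φτστ m (𝕩^ (k₁ ∸ 1) ++ idxWord k′))
LHS≋Φτστ k₁ k′ pos (ks , kr , eq , 2≤kr) m = begin
  LHS (k₁ ∷ k′) m                                            ≡⟨ cong (λ k → LHS k m) eq ⟩
  LHS (ks ++ [ kr ]) m                                       ≈⟨ LHS≋Itw-σw ks kr 2≤kr pos-ks m ⟩
  concatMap (Itw ∘ τw) (σw m (τw (idxWord (ks ++ [ kr ]))))  ≡⟨ cong (λ k → concatMap (Itw ∘ τw) (σw m (τw (idxWord k)))) eq ⟨
  concatMap (Itw ∘ τw) (σw m (τw (idxWord (k₁ ∷ k′))))       ≡⟨ Itw-σw-y k₁ k′ m ⟩
  lmul 𝕪 (Φτστ m (𝕩^ (k₁ ∸ 1) ++ idxWord k′))               ∎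
  where
  open ≋-Reasoning
  pos-ks : All (1 ≤_) ks
  pos-ks = AllP.++⁻ˡ ks (subst (All (1 ≤_)) eq pos)

-- Binomial coefficients with integer top

ℚι : ℤ → ℚ
ℚι i = i ℚ./ 1

inv1+ : ℕ → ℚ
inv1+ d = + 1 ℚ./ suc d

toℚᵘ-/ : ∀ i d → ℚ.toℚᵘ (i ℚ./ suc d) ℚᵘ.≃ mkℚᵘ i d
toℚᵘ-/ i d = QP.toℚᵘ-fromℚᵘ (mkℚᵘ i d)

ℚι-+ : ∀ a b → ℚι (a ℤ.+ b) ≡ ℚι a ℚ.+ ℚι b
ℚι-+ a b = QP.toℚᵘ-injective (begin
  ℚ.toℚᵘ (ℚι (a ℤ.+ b))             ≈⟨ toℚᵘ-/ (a ℤ.+ b) 0 ⟩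
  mkℚᵘ (a ℤ.+ b) 0                  ≈⟨ *≡* (cross a b) ⟩
  mkℚᵘ a 0 ℚᵘ.+ mkℚᵘ b 0            ≈⟨ UP.+-cong (toℚᵘ-/ a 0) (toℚᵘ-/ b 0) ⟨
  ℚ.toℚᵘ (ℚι a) ℚᵘ.+ ℚ.toℚᵘ (ℚι b)  ≈⟨ QP.toℚᵘ-homo-+ (ℚι a) (ℚι b) ⟨
  ℚ.toℚᵘ (ℚι a ℚ.+ ℚι b)            ∎)
  where
  open SetoidReasoning UP.≃-setoid
  cross : ∀ a b → (a ℤ.+ b) ℤ.* + 1 ≡ (a ℤ.* + 1 ℤ.+ b ℤ.* + 1) ℤ.* + 1
  cross = ZS.solve-∀

/-as-* : ∀ i d → i ℚ./ suc d ≡ ℚι i ℚ.* inv1+ d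
/-as-* i d = QP.toℚᵘ-injective (begin
  ℚ.toℚᵘ (i ℚ./ suc d)                 ≈⟨ toℚᵘ-/ i d ⟩
  mkℚᵘ i d                             ≈⟨ *≡* (cross i (+ suc d)) ⟩
  mkℚᵘ i 0 ℚᵘ.* mkℚᵘ (+ 1) d           ≈⟨ UP.*-cong (toℚᵘ-/ i 0) (toℚᵘ-/ (+ 1) d) ⟨
  ℚ.toℚᵘ (ℚι i) ℚᵘ.* ℚ.toℚᵘ (inv1+ d)  ≈⟨ QP.toℚᵘ-homo-* (ℚι i) (inv1+ d) ⟨
  ℚ.toℚᵘ (ℚι i ℚ.* inv1+ d)            ∎)
  where
  open SetoidReasoning UP.≃-setoid
  cross : ∀ i D → i ℤ.* (+ 1 ℤ.* D) ≡ (i ℤ.* + 1) ℤ.* D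
  cross = ZS.solve-∀

ℚι-suc : ∀ j → ℚι (+ suc j) ≡ ℚι (+ j) ℚ.+ 1ℚ
ℚι-suc j = trans (cong ℚι (trans (ZP.pos-+ 1 j) (ZP.+-comm (+ 1) (+ j)))) (ℚι-+ (+ j) (+ 1))

ℚι-suc-*-inv1+ : ∀ j → (ℚι (+ j) ℚ.+ 1ℚ) ℚ.* inv1+ j ≡ 1ℚ
ℚι-suc-*-inv1+ j = begin
  (ℚι (+ j) ℚ.+ 1ℚ) ℚ.* inv1+ j  ≡⟨ cong (ℚ._* inv1+ j) (ℚι-suc j) ⟨
  ℚι (+ suc j) ℚ.* inv1+ j       ≡⟨ /-as-* (+ suc j) j ⟨
  + suc j ℚ./ suc j              ≡⟨ QP.toℚᵘ-injective (UP.≃-trans (toℚᵘ-/ (+ suc j) j) (*≡* (ZP.*-comm (+ suc j) (+ 1)))) ⟩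
  1ℚ                             ∎
  where open ≡-Reasoning

inv1+-telescope : ∀ j → inv1+ j ≡ inv1+ (suc j) ℚ.+ inv1+ j ℚ.* inv1+ (suc j)
inv1+-telescope j = begin
  I₁                                       ≡⟨ QP.*-identityʳ I₁ ⟨
  I₁ ℚ.* 1ℚ                                ≡⟨ cong (I₁ ℚ.*_) (ℚι-suc-*-inv1+ (suc j)) ⟨
  I₁ ℚ.* ((J₁ ℚ.+ 1ℚ) ℚ.* I₂)              ≡⟨ cong (λ x → I₁ ℚ.* ((x ℚ.+ 1ℚ) ℚ.* I₂)) (ℚι-suc j) ⟩
  I₁ ℚ.* (((J ℚ.+ 1ℚ) ℚ.+ 1ℚ) ℚ.* I₂)      ≡⟨ expand J I₁ I₂ ⟩
  ((J ℚ.+ 1ℚ) ℚ.* I₁) ℚ.* I₂ ℚ.+ I₁ ℚ.* I₂  ≡⟨ cong (λ x → x ℚ.* I₂ ℚ.+ I₁ ℚ.* I₂) (ℚι-suc-*-inv1+ j) ⟩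
  1ℚ ℚ.* I₂ ℚ.+ I₁ ℚ.* I₂                  ≡⟨ cong (ℚ._+ I₁ ℚ.* I₂) (QP.*-identityˡ I₂) ⟩
  I₂ ℚ.+ I₁ ℚ.* I₂                         ∎
  where
  open ≡-Reasoning
  J = ℚι (+ j)
  J₁ = ℚι (+ suc j)
  I₁ = inv1+ j
  I₂ = inv1+ (suc j)
  expand : ∀ J I₁ I₂ → I₁ ℚ.* (((J ℚ.+ 1ℚ) ℚ.+ 1ℚ) ℚ.* I₂) ≡ ((J ℚ.+ 1ℚ) ℚ.* I₁) ℚ.* I₂ ℚ.+ I₁ ℚ.* I₂
  expand = solve 3 (λ J I₁ I₂ → I₁ :* (((J :+ con 1ℚ) :+ con 1ℚ) :* I₂) := ((J :+ con 1ℚ) :* I₁) :* I₂ :+ I₁ :* I₂) refl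

binomℤ-suc : ∀ N j → binomℤ N (suc j) ≡ binomℤ N j ℚ.* ((ℚι N ℚ.- ℚι (+ j)) ℚ.* inv1+ j)
binomℤ-suc N j = cong (binomℤ N j ℚ.*_) (begin
  (N ℤ.- + j) ℚ./ suc j                     ≡⟨ /-as-* (N ℤ.- + j) j ⟩
  ℚι (N ℤ.- + j) ℚ.* inv1+ j                ≡⟨ cong (ℚ._* inv1+ j) (ℚι-+ N (ℤ.- + j)) ⟩
  (ℚι N ℚ.+ ℚι (ℤ.- + j)) ℚ.* inv1+ j       ≡⟨ cong (λ x → (ℚι N ℚ.+ x) ℚ.* inv1+ j) (ℚι-neg (+ j)) ⟩
  (ℚι N ℚ.- ℚι (+ j)) ℚ.* inv1+ j           ∎)
  where
  open ≡-Reasoning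
  ℚι-neg : ∀ a → ℚι (ℤ.- a) ≡ ℚ.- ℚι a
  ℚι-neg a = QP.toℚᵘ-injective (UP.≃-trans (toℚᵘ-/ (ℤ.- a) 0)
    (UP.≃-sym (UP.≃-trans (QP.toℚᵘ-homo‿- (ℚι a)) (UP.-‿cong (toℚᵘ-/ a 0)))))

binomℤ-vanish : ∀ a j → a < j → binomℤ (+ a) j ≡ 0ℚ
binomℤ-vanish a (suc j) (s≤s a≤j) with a ℕ.≟ j
... | yes refl = begin
  binomℤ (+ a) a ℚ.* ((+ a ℤ.- + a) ℚ./ suc a)  ≡⟨ cong (λ i → binomℤ (+ a) a ℚ.* (i ℚ./ suc a)) (ZP.+-inverseʳ (+ a)) ⟩
  binomℤ (+ a) a ℚ.* (+ 0 ℚ./ suc a)            ≡⟨ cong (binomℤ (+ a) a ℚ.*_) (trans (/-as-* (+ 0) a) (QP.*-zeroˡ (inv1+ a))) ⟩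
  binomℤ (+ a) a ℚ.* 0ℚ                         ≡⟨ QP.*-zeroʳ (binomℤ (+ a) a) ⟩
  0ℚ                                            ∎
  where open ≡-Reasoning
... | no a≢j = begin
  binomℤ (+ a) j ℚ.* r  ≡⟨ cong (ℚ._* r) (binomℤ-vanish a j (NP.≤∧≢⇒< a≤j a≢j)) ⟩
  0ℚ ℚ.* r              ≡⟨ QP.*-zeroˡ r ⟩
  0ℚ                    ∎
  where
  open ≡-Reasoning
  r = (+ a ℤ.- + j) ℚ./ suc j

binomℤ-pascal : ∀ j N → binomℤ (N ℤ.+ + 1) (suc j) ≡ binomℤ N (suc j) ℚ.+ binomℤ N j
binomℤ-pascal zero N = begin
  1ℚ ℚ.* ((N ℤ.+ + 1 ℤ.- + 0) ℚ./ 1)  ≡⟨ QP.*-identityˡ _ ⟩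
  ℚι (N ℤ.+ + 1 ℤ.+ + 0)              ≡⟨ cong ℚι (ZP.+-identityʳ (N ℤ.+ + 1)) ⟩
  ℚι (N ℤ.+ + 1)                      ≡⟨ ℚι-+ N (+ 1) ⟩
  ℚι N ℚ.+ 1ℚ                         ≡⟨ cong (ℚ._+ 1ℚ) (trans (QP.*-identityˡ (ℚι (N ℤ.+ + 0))) (cong ℚι (ZP.+-identityʳ N))) ⟨
  1ℚ ℚ.* ((N ℤ.- + 0) ℚ./ 1) ℚ.+ 1ℚ  ∎
  where open ≡-Reasoning
binomℤ-pascal (suc j) N = begin
  binomℤ (N ℤ.+ + 1) (suc (suc j))
    ≡⟨ binomℤ-suc (N ℤ.+ + 1) (suc j) ⟩
  binomℤ (N ℤ.+ + 1) (suc j) ℚ.* ((ℚι (N ℤ.+ + 1) ℚ.- ℚι (+ suc j)) ℚ.* I₂)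
    ≡⟨ cong₂ (λ b x → b ℚ.* (x ℚ.* I₂)) (trans (binomℤ-pascal j N) (cong (ℚ._+ B) (binomℤ-suc N j))) shift ⟩
  (B ℚ.* (Δ ℚ.* I₁) ℚ.+ B) ℚ.* (Δ ℚ.* I₂)
    ≡⟨ regroup B Δ I₁ I₂ ⟩
  B ℚ.* (Δ ℚ.* I₁) ℚ.* ((Δ ℚ.- 1ℚ) ℚ.* I₂) ℚ.+ B ℚ.* (Δ ℚ.* (I₂ ℚ.+ I₁ ℚ.* I₂))
    ≡⟨ cong₂ (λ x i → B ℚ.* (Δ ℚ.* I₁) ℚ.* (x ℚ.* I₂) ℚ.+ B ℚ.* (Δ ℚ.* i)) shift-1 (inv1+-telescope j) ⟨
  B ℚ.* (Δ ℚ.* I₁) ℚ.* ((ℚι N ℚ.- ℚι (+ suc j)) ℚ.* I₂) ℚ.+ B ℚ.* (Δ ℚ.* I₁)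
    ≡⟨ cong (λ b → b ℚ.* ((ℚι N ℚ.- ℚι (+ suc j)) ℚ.* I₂) ℚ.+ b) (binomℤ-suc N j) ⟨
  binomℤ N (suc j) ℚ.* ((ℚι N ℚ.- ℚι (+ suc j)) ℚ.* I₂) ℚ.+ binomℤ N (suc j)
    ≡⟨ cong (ℚ._+ binomℤ N (suc j)) (binomℤ-suc N (suc j)) ⟨
  binomℤ N (suc (suc j)) ℚ.+ binomℤ N (suc j)
    ∎
  where
  open ≡-Reasoning
  B = binomℤ N j
  Δ = ℚι N ℚ.- ℚι (+ j)
  I₁ = inv1+ j
  I₂ = inv1+ (suc j)
  shift : ℚι (N ℤ.+ + 1) ℚ.- ℚι (+ suc j) ≡ Δ
  shift = trans (cong₂ ℚ._-_ (ℚι-+ N (+ 1)) (ℚι-suc j)) (cancel (ℚι N) (ℚι (+ j)))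
    where
    cancel : ∀ n j → (n ℚ.+ 1ℚ) ℚ.- (j ℚ.+ 1ℚ) ≡ n ℚ.- j
    cancel = solve 2 (λ n j → (n :+ con 1ℚ) :- (j :+ con 1ℚ) := n :- j) refl
  shift-1 : ℚι N ℚ.- ℚι (+ suc j) ≡ Δ ℚ.- 1ℚ
  shift-1 = trans (cong (λ x → ℚι N ℚ.- x) (ℚι-suc j)) (reassoc (ℚι N) (ℚι (+ j)))
    where
    reassoc : ∀ n j → n ℚ.- (j ℚ.+ 1ℚ) ≡ (n ℚ.- j) ℚ.- 1ℚ
    reassoc = solve 2 (λ n j → n :- (j :+ con 1ℚ) := (n :- j) :- con 1ℚ) refl
  regroup : ∀ B Δ I₁ I₂ → (B ℚ.* (Δ ℚ.* I₁) ℚ.+ B) ℚ.* (Δ ℚ.* I₂) ≡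
            B ℚ.* (Δ ℚ.* I₁) ℚ.* ((Δ ℚ.- 1ℚ) ℚ.* I₂) ℚ.+ B ℚ.* (Δ ℚ.* (I₂ ℚ.+ I₁ ℚ.* I₂))
  regroup = solve 4 (λ B Δ I₁ I₂ → (B :* (Δ :* I₁) :+ B) :* (Δ :* I₂) :=
            B :* (Δ :* I₁) :* ((Δ :- con 1ℚ) :* I₂) :+ B :* (Δ :* (I₂ :+ I₁ :* I₂))) refl

binomTerm : ℚ → ℕ → ℕ → Term → Term
binomTerm b e K (c , n , w) = (b ℚ.* c , e + n , 𝕩^ K ++ w)

-2ℤ : ℤ
-2ℤ = -[1+ 1 ]

binomCoeff : ℤ → ℕ → ℕ → ℚ
binomCoeff o p e = binomℤ (+ p ℤ.+ + e ℤ.+ o) e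

binomPoly : ℤ → ℕ → ℕ → Poly → Poly
binomPoly o p e = map (binomTerm (binomCoeff o p e) e (p + e))

-- mulBinomial o p S = x^p Σₑ binom(p + e + o, e) (x t u)^e · S;
-- it is x′^p S for o = −1, and (1 − x t u) S for o = −2, p = 0.
mulBinomial : ℤ → ℕ → Series → Series
mulBinomial o p S m = sumBelow (suc m) (λ e → binomPoly o p e (S (m ∸ e)))

binomTerm-scale : ∀ b e K P → map (binomTerm b e K) P ≡ scale b (map (binomTerm 1ℚ e K) P)
binomTerm-scale b e K P = trans (LP.map-cong (λ { (c , n , w) → cong (λ z → (z , e + n , 𝕩^ K ++ w)) (cong (b ℚ.*_) (sym (QP.*-identityˡ c))) }) P)
  (sym (map-map (scaleTerm b) (binomTerm 1ℚ e K) P))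

scale-+ : ∀ b1 b2 Z → scale b1 Z ++ scale b2 Z ≋ scale (b1 ℚ.+ b2) Z
scale-+ b1 b2 Z = ≋i λ n w → trans (coeff-++ (scale b1 Z) (scale b2 Z) n w)
  (trans (cong₂ ℚ._+_ (coeff-scale b1 Z n w) (coeff-scale b2 Z n w))
  (trans (sym (QP.*-distribʳ-+ (coeff Z n w) b1 b2)) (sym (coeff-scale (b1 ℚ.+ b2) Z n w))))

binomTerm-+ : ∀ b1 b2 e K P → map (binomTerm b1 e K) P ++ map (binomTerm b2 e K) P ≋ map (binomTerm (b1 ℚ.+ b2) e K) P
binomTerm-+ b1 b2 e K P = ≋-trans (≡⇒≋ (cong₂ _++_ (binomTerm-scale b1 e K P) (binomTerm-scale b2 e K P)))
  (≋-trans (scale-+ b1 b2 (map (binomTerm 1ℚ e K) P)) (≡⇒≋ (sym (binomTerm-scale (b1 ℚ.+ b2) e K P))))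

binomTerm-cong≋ : ∀ b e K {P Q} → P ≋ Q → map (binomTerm b e K) P ≋ map (binomTerm b e K) Q
binomTerm-cong≋ b e K = map-linear-cong (binomTerm b e K) (λ c n w → cong (λ c' → (c' , e + n , 𝕩^ K ++ w)) (linear c))
  where
  linear : ∀ c → b ℚ.* c ≡ c ℚ.* (b ℚ.* 1ℚ)
  linear c = trans (QP.*-comm b c) (cong (c ℚ.*_) (sym (QP.*-identityʳ b)))

binomTerm-tmul : ∀ b e K P → map (binomTerm b e K) (tmul P) ≡ tmul (map (binomTerm b e K) P)
binomTerm-tmul b e K P = trans (map-map (binomTerm b e K) tmulTerm P) (trans (LP.map-cong (λ { (c , n , w) → cong (λ z → (b ℚ.* c , z , 𝕩^ K ++ w)) (NP.+-suc e n) }) P)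
  (sym (map-map tmulTerm (binomTerm b e K) P)))

binomTerm-lmul-x : ∀ b e K P → map (binomTerm b e K) (lmul 𝕩 P) ≡ lmul 𝕩 (map (binomTerm b e K) P)
binomTerm-lmul-x b e K P = trans (map-map (binomTerm b e K) (lmulTerm 𝕩) P) (trans (LP.map-cong (λ { (c , n , w) → cong (λ z → (b ℚ.* c , e + n , z)) (replicate-++-∷ K 𝕩 w) }) P)
  (sym (map-map (lmulTerm 𝕩) (binomTerm b e K) P)))

mulBinomial-cong≋ : ∀ o p {S S' : Series} → (∀ i → S i ≋ S' i) → ∀ m → mulBinomial o p S m ≋ mulBinomial o p S' m
mulBinomial-cong≋ o p e m = sumBelow-cong≋ (suc m) (λ j _ → binomTerm-cong≋ (binomCoeff o p j) j (p + j) (e (m ∸ j)))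

mulBinomial-++ : ∀ o p (S S' : Series) m → mulBinomial o p (λ i → S i ++ S' i) m ≋ mulBinomial o p S m ++ mulBinomial o p S' m
mulBinomial-++ o p S S' m = ≋-trans (≡⇒≋ (sumBelow-cong (suc m) (λ e _ → LP.map-++ (binomTerm (binomCoeff o p e) e (p + e)) (S (m ∸ e)) (S' (m ∸ e)))))
  (sumBelow-split (suc m) (λ e → binomPoly o p e (S (m ∸ e))) (λ e → binomPoly o p e (S' (m ∸ e))))

mulBinomial-map : ∀ o p (h : Term → Term) (S : Series) m → (∀ b e K P → map (binomTerm b e K) (map h P) ≡ map h (map (binomTerm b e K) P)) →
  mulBinomial o p (λ i → map h (S i)) m ≡ map h (mulBinomial o p S m)
mulBinomial-map o p h S m hc = trans (sumBelow-cong (suc m) (λ e _ → hc (binomCoeff o p e) e (p + e) (S (m ∸ e))))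
  (sym (map-sumBelow h (suc m) (λ e → binomPoly o p e (S (m ∸ e)))))

mulBinomial-tmul : ∀ o p S m → mulBinomial o p (λ i → tmul (S i)) m ≡ tmul (mulBinomial o p S m)
mulBinomial-tmul o p S m = mulBinomial-map o p tmulTerm S m binomTerm-tmul

mulBinomial-lmul-x : ∀ o p S m → mulBinomial o p (λ i → lmul 𝕩 (S i)) m ≡ lmul 𝕩 (mulBinomial o p S m)
mulBinomial-lmul-x o p S m = mulBinomial-map o p (lmulTerm 𝕩) S m binomTerm-lmul-x

mulBinomial-mulU : ∀ o p S m → mulBinomial o p (mulU S) (suc m) ≋ mulBinomial o p S m
mulBinomial-mulU o p S m = ≋-trans (≡⇒≋ (sumBelow-suc (suc m) f))
  (≋-trans (++-cong (≡⇒≋ (sumBelow-cong (suc m) shiftIndex)) (≡⇒≋ {f (suc m)} {[]} (cong (λ z → binomPoly o p (suc m) (mulU S z)) (NP.n∸n≡0 m))))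
  (++-identityʳ≋ (mulBinomial o p S m)))
  where
  f : ℕ → Poly
  f e = binomPoly o p e (mulU S (suc m ∸ e))
  shiftIndex : ∀ e → e < suc m → f e ≡ binomPoly o p e (S (m ∸ e))
  shiftIndex e e<sm rewrite NP.+-∸-assoc 1 (NP.≤-pred e<sm) = refl

mulBinomial-cong : ∀ o p {S S' : Series} → (∀ i → S i ≡ S' i) → ∀ m → mulBinomial o p S m ≡ mulBinomial o p S' m
mulBinomial-cong o p e m = sumBelow-cong (suc m) (λ j _ → cong (binomPoly o p j) (e (m ∸ j)))

mulX′-unique : ∀ (V T : Series) → (∀ m → V m ≋ lmul 𝕩 (T m ++ tmul (mulU V m))) → ∀ m → V m ≋ mulX′ T m
mulX′-unique V T h zero = ≋-trans (h 0) (lmul-cong 𝕩 (++-identityʳ≋ (T 0)))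
mulX′-unique V T h (suc m) = ≋-trans (h (suc m)) (lmul-cong 𝕩 (++-cong (≋-refl {T (suc m)}) (tmul-cong (mulX′-unique V T h m))))

mulX′-cong : ∀ {T T' : Series} → (∀ i → T i ≋ T' i) → ∀ m → mulX′ T m ≋ mulX′ T' m
mulX′-cong e zero = lmul-cong 𝕩 (e 0)
mulX′-cong e (suc m) = lmul-cong 𝕩 (++-cong (e (suc m)) (tmul-cong (mulX′-cong e m)))

mulX′^ : ℕ → Series → Series
mulX′^ zero S = S
mulX′^ (suc a) S = mulX′ (mulX′^ a S)

substitute-𝕩^ : ∀ a v i → substitute (𝕩^ a ++ v) i ≋ mulX′^ a (substitute v) i
substitute-𝕩^ zero v i = ≋-refl
substitute-𝕩^ (suc a) v i = mulX′-cong (substitute-𝕩^ a v) i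

binomTerm-zero : ∀ e K P → map (binomTerm 0ℚ e K) P ≋ []
binomTerm-zero e K P = ≋i λ n w → begin
  coeff (map (binomTerm 0ℚ e K) P) n w    ≡⟨ cong (λ Q → coeff Q n w) (binomTerm-scale 0ℚ e K P) ⟩
  coeff (scale 0ℚ Q) n w                  ≡⟨ coeff-scale 0ℚ Q n w ⟩
  0ℚ ℚ.* coeff Q n w                      ≡⟨ QP.*-zeroˡ (coeff Q n w) ⟩
  0ℚ                                      ∎
  where
  open ≡-Reasoning
  Q = map (binomTerm 1ℚ e K) P

binomTerm-one : ∀ P → map (binomTerm 1ℚ 0 0) P ≡ P
binomTerm-one P = trans (LP.map-cong (λ { (c , n , w) → cong (λ z → (z , n , w)) (QP.*-identityˡ c) }) P) (LP.map-id P)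

mulBinomial-one : ∀ S m → mulBinomial -1ℤ 0 S m ≋ S m
mulBinomial-one S m = ≋-trans (++-cong (≡⇒≋ (binomTerm-one (S m))) (sumBelow-zero m (λ e _ → vanish e))) (++-identityʳ≋ (S m))
  where
  vanish : ∀ e → binomPoly -1ℤ 0 (suc e) (S (m ∸ suc e)) ≋ []
  vanish e = ≋-trans (≡⇒≋ (cong (λ b → map (binomTerm b (suc e) (suc e)) (S (m ∸ suc e))) (binomℤ-vanish e (suc e) (NP.n<1+n e)))) (binomTerm-zero (suc e) (suc e) _)

mulBinomial-1-xtu : ∀ S m → mulBinomial -2ℤ 0 S m ≋ S m ++ neg (tmul (lmul 𝕩 (mulU S m)))
mulBinomial-1-xtu S zero = ≡⇒≋ (cong (_++ []) (binomTerm-one (S 0)))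
mulBinomial-1-xtu S (suc m) = ++-cong (≡⇒≋ (binomTerm-one (S (suc m))))
  (≋-trans (++-cong (≡⇒≋ linearTerm) (sumBelow-zero m (λ e _ → vanish e))) (++-identityʳ≋ _))
  where
  linearTerm : map (binomTerm (ℚ.- 1ℚ) 1 1) (S m) ≡ neg (tmul (lmul 𝕩 (S m)))
  linearTerm = trans (LP.map-cong (λ { (c , n , w) → cong (λ c' → (c' , suc n , 𝕩 ∷ w)) (trans (sym (QP.neg-distribˡ-* 1ℚ c)) (cong ℚ.-_ (QP.*-identityˡ c))) }) (S m))
    (sym (trans (map-map negTerm tmulTerm _) (trans (map-map (negTerm ∘ tmulTerm) (lmulTerm 𝕩) (S m)) refl)))
  vanish : ∀ e → binomPoly -2ℤ 0 (suc (suc e)) (S (m ∸ suc e)) ≋ []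
  vanish e = ≋-trans (≡⇒≋ (cong (λ b → map (binomTerm b (suc (suc e)) (suc (suc e))) (S (m ∸ suc e))) (binomℤ-vanish e (suc (suc e)) (NP.m≤n⇒m≤1+n (NP.n<1+n e))))) (binomTerm-zero (suc (suc e)) (suc (suc e)) _)

binomCoeff-pascal : ∀ o p e → binomCoeff o (suc p) (suc e) ≡ binomCoeff o p (suc e) ℚ.+ binomCoeff o (suc p) e
binomCoeff-pascal o p e = begin
  binomℤ (+ suc p ℤ.+ + suc e ℤ.+ o) (suc e)               ≡⟨ cong (λ z → binomℤ z (suc e)) (shift₁ (+ p) (+ e) o) ⟩
  binomℤ (N ℤ.+ + 1) (suc e)                               ≡⟨ binomℤ-pascal e N ⟩
  binomℤ N (suc e) ℚ.+ binomℤ N e                          ≡⟨ cong (λ z → binomℤ N (suc e) ℚ.+ binomℤ z e) (shift₂ (+ p) (+ e) o) ⟨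
  binomℤ N (suc e) ℚ.+ binomℤ (+ suc p ℤ.+ + e ℤ.+ o) e    ∎
  where
  open ≡-Reasoning
  N = + p ℤ.+ + suc e ℤ.+ o
  shift₁ : ∀ P E O → (+ 1 ℤ.+ P) ℤ.+ (+ 1 ℤ.+ E) ℤ.+ O ≡ (P ℤ.+ (+ 1 ℤ.+ E) ℤ.+ O) ℤ.+ + 1
  shift₁ = ZS.solve-∀
  shift₂ : ∀ P E O → (+ 1 ℤ.+ P) ℤ.+ E ℤ.+ O ≡ P ℤ.+ (+ 1 ℤ.+ E) ℤ.+ O
  shift₂ = ZS.solve-∀

binomPoly-pascal : ∀ o p e Z →
  binomPoly o (suc p) (suc e) Z ≋ lmul 𝕩 (binomPoly o p (suc e) Z) ++ lmul 𝕩 (tmul (binomPoly o (suc p) e Z))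
binomPoly-pascal o p e Z = begin
  binomPoly o (suc p) (suc e) Z
    ≡⟨ cong (λ b → map (binomTerm b (suc e) K) Z) (binomCoeff-pascal o p e) ⟩
  map (binomTerm (b₁ ℚ.+ b₂) (suc e) K) Z
    ≈⟨ binomTerm-+ b₁ b₂ (suc e) K Z ⟨
  map (binomTerm b₁ (suc e) K) Z ++ map (binomTerm b₂ (suc e) K) Z
    ≡⟨ cong₂ _++_ (map-map (lmulTerm 𝕩) (binomTerm b₁ (suc e) (p + suc e)) Z) (LP.map-cong shift Z) ⟨
  lmul 𝕩 (binomPoly o p (suc e) Z) ++ map (lmulTerm 𝕩 ∘ tmulTerm ∘ binomTerm b₂ e (suc p + e)) Z
    ≡⟨ cong (lmul 𝕩 (binomPoly o p (suc e) Z) ++_) (trans (cong (lmul 𝕩) (map-map tmulTerm (binomTerm b₂ e (suc p + e)) Z))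
                                                          (map-map (lmulTerm 𝕩) (tmulTerm ∘ binomTerm b₂ e (suc p + e)) Z)) ⟨
  lmul 𝕩 (binomPoly o p (suc e) Z) ++ lmul 𝕩 (tmul (binomPoly o (suc p) e Z))
    ∎
  where
  open ≋-Reasoning
  K = suc p + suc e
  b₁ = binomCoeff o p (suc e)
  b₂ = binomCoeff o (suc p) e
  shift : ∀ t → lmulTerm 𝕩 (tmulTerm (binomTerm b₂ e (suc p + e) t)) ≡ binomTerm b₂ (suc e) K t
  shift (c , n , w) = cong (λ K′ → (b₂ ℚ.* c , suc (e + n) , 𝕩 ∷ 𝕩^ K′ ++ w)) (sym (NP.+-suc p e))

mulBinomial-suc : ∀ o p S m → mulBinomial o (suc p) S m ≋ mulX′ (mulBinomial o p S) m
mulBinomial-suc o p S = mulX′-unique (mulBinomial o (suc p) S) (mulBinomial o p S) recursion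
  where
  recursion : ∀ m → mulBinomial o (suc p) S m ≋ lmul 𝕩 (mulBinomial o p S m ++ tmul (mulU (mulBinomial o (suc p) S) m))
  recursion zero = begin
    binomPoly o (suc p) 0 (S 0) ++ []                ≈⟨ ++-identityʳ≋ (binomPoly o (suc p) 0 (S 0)) ⟩
    binomPoly o (suc p) 0 (S 0)                      ≡⟨ map-map (lmulTerm 𝕩) (binomTerm 1ℚ 0 (p + 0)) (S 0) ⟨
    lmul 𝕩 (binomPoly o p 0 (S 0))                   ≈⟨ lmul-cong 𝕩 (++-identityʳ≋ (binomPoly o p 0 (S 0))) ⟨
    lmul 𝕩 (binomPoly o p 0 (S 0) ++ [])             ≈⟨ lmul-cong 𝕩 (++-identityʳ≋ (binomPoly o p 0 (S 0) ++ [])) ⟨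
    lmul 𝕩 ((binomPoly o p 0 (S 0) ++ []) ++ [])     ∎
    where open ≋-Reasoning
  recursion (suc m) = begin
    binomPoly o (suc p) 0 (S (suc m)) ++ sumBelow (suc m) (λ e → binomPoly o (suc p) (suc e) (S (m ∸ e)))
      ≈⟨ ++-cong (≡⇒≋ (sym (map-map (lmulTerm 𝕩) (binomTerm 1ℚ 0 (p + 0)) (S (suc m)))))
                 (sumBelow-cong≋ (suc m) (λ e _ → binomPoly-pascal o p e (S (m ∸ e)))) ⟩
    lmul 𝕩 (T 0) ++ sumBelow (suc m) (λ e → lmul 𝕩 (T (suc e)) ++ lmul 𝕩 (tmul (T′ e)))
      ≈⟨ ++-cong (≋-refl {lmul 𝕩 (T 0)}) (sumBelow-split (suc m) (lmul 𝕩 ∘ T ∘ suc) (lmul 𝕩 ∘ tmul ∘ T′)) ⟩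
    lmul 𝕩 (T 0) ++ (sumBelow (suc m) (lmul 𝕩 ∘ T ∘ suc) ++ sumBelow (suc m) (lmul 𝕩 ∘ tmul ∘ T′))
      ≈⟨ ++-assoc≋ (lmul 𝕩 (T 0)) _ _ ⟨
    (lmul 𝕩 (T 0) ++ sumBelow (suc m) (lmul 𝕩 ∘ T ∘ suc)) ++ sumBelow (suc m) (lmul 𝕩 ∘ tmul ∘ T′)
      ≡⟨ cong₂ _++_ (trans (LP.map-++ (lmulTerm 𝕩) (T 0) _) (cong (lmul 𝕩 (T 0) ++_) (map-sumBelow (lmulTerm 𝕩) (suc m) (T ∘ suc))))
                    (trans (cong (lmul 𝕩) (map-sumBelow tmulTerm (suc m) T′)) (map-sumBelow (lmulTerm 𝕩) (suc m) (tmul ∘ T′))) ⟨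
    lmul 𝕩 (mulBinomial o p S (suc m)) ++ lmul 𝕩 (tmul (mulBinomial o (suc p) S m))
      ≡⟨ LP.map-++ (lmulTerm 𝕩) (mulBinomial o p S (suc m)) _ ⟨
    lmul 𝕩 (mulBinomial o p S (suc m) ++ tmul (mulBinomial o (suc p) S m))
      ∎
    where
    open ≋-Reasoning
    T T′ : ℕ → Poly
    T e = binomPoly o p e (S (suc m ∸ e))
    T′ e = binomPoly o (suc p) e (S (m ∸ e))

mulBinomial-mulX′ : ∀ o p S m → mulBinomial o p (mulX′ S) m ≋ mulX′ (mulBinomial o p S) m
mulBinomial-mulX′ o p S = mulX′-unique V (mulBinomial o p S) recursion
  where
  V = mulBinomial o p (mulX′ S)
  mulU-comm : ∀ m → mulBinomial o p (mulU (mulX′ S)) m ≋ mulU V m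
  mulU-comm zero = ≋-refl
  mulU-comm (suc m) = mulBinomial-mulU o p (mulX′ S) m
  recursion : ∀ m → V m ≋ lmul 𝕩 (mulBinomial o p S m ++ tmul (mulU V m))
  recursion m = begin
    mulBinomial o p (mulX′ S) m ≡⟨ mulBinomial-cong o p (mulX′-unfold S) m ⟩
    mulBinomial o p (λ i → lmul 𝕩 (S i ++ tmul (mulU (mulX′ S) i))) m ≡⟨ mulBinomial-lmul-x o p (λ i → S i ++ tmul (mulU (mulX′ S) i)) m ⟩
    lmul 𝕩 (mulBinomial o p (λ i → S i ++ tmul (mulU (mulX′ S) i)) m) ≈⟨ lmul-cong 𝕩 (mulBinomial-++ o p S (λ i → tmul (mulU (mulX′ S) i)) m) ⟩
    lmul 𝕩 (mulBinomial o p S m ++ mulBinomial o p (λ i → tmul (mulU (mulX′ S) i)) m) ≡⟨ cong (λ z → lmul 𝕩 (mulBinomial o p S m ++ z)) (mulBinomial-tmul o p (mulU (mulX′ S)) m) ⟩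
    lmul 𝕩 (mulBinomial o p S m ++ tmul (mulBinomial o p (mulU (mulX′ S)) m)) ≈⟨ lmul-cong 𝕩 (++-cong (≋-refl {mulBinomial o p S m}) (tmul-cong (mulU-comm m))) ⟩
    lmul 𝕩 (mulBinomial o p S m ++ tmul (mulU V m)) ∎
    where open ≋-Reasoning

mulBinomial-mulX′^ : ∀ o p a S m → mulBinomial o p (mulX′^ a S) m ≋ mulBinomial o (p + a) S m
mulBinomial-mulX′^ o p zero S m = ≡⇒≋ (cong (λ z → mulBinomial o z S m) (sym (NP.+-identityʳ p)))
mulBinomial-mulX′^ o p (suc a) S m = ≋-trans (mulBinomial-mulX′ o p (mulX′^ a S) m)
  (≋-trans (mulX′-cong (mulBinomial-mulX′^ o p a S) m) (≋-trans (≋-sym (mulBinomial-suc o (p + a) S m)) (≡⇒≋ (cong (λ z → mulBinomial o z S m) (sym (NP.+-suc p a))))))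

mulBinomial-substitute-𝕩^ : ∀ o p a v m → mulBinomial o p (substitute (𝕩^ a ++ v)) m ≋ mulBinomial o (p + a) (substitute v) m
mulBinomial-substitute-𝕩^ o p a v m =
  ≋-trans (mulBinomial-cong≋ o p (substitute-𝕩^ a v) m) (mulBinomial-mulX′^ o p a (substitute v) m)

-- The right-hand side

-- X′ o p q k generalises X k = X′ −1 0 0 k: in the first block the binomial top is shifted by p + o + 1
-- and the exponent of x by q.
Xcoef′ : ℤ → ℕ → List Index → List ℕ → ℚ
Xcoef′ o p (b ∷ bs) (e ∷ es) = binomℤ (((+ wt b ℤ.- + dep b) ℤ.+ + p) ℤ.+ + e ℤ.+ o) e ℚ.* Xcoef false bs es
Xcoef′ o p _ _ = 1ℚ

Xword′ : ℕ → List Index → List ℕ → Word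
Xword′ q (b ∷ bs) (e ∷ es) = 𝕪 ∷ replicate (wt b + q + e ∸ 1) 𝕩 ++ Xword bs es
Xword′ q _ _ = []

Xterm : ℤ → ℕ → ℕ → Index → ℕ → List Index → List ℕ → Term
Xterm o p q k m B e = (Xcoef′ o p B e , dep k ∸ length B + m , Xword′ q B e)

Xblocks : ℤ → ℕ → ℕ → Index → ℕ → List Index → Poly
Xblocks o p q k m B = map (Xterm o p q k m B) (comps m (length B))

X′ : ℤ → ℕ → ℕ → Index → ℕ → Poly
X′ o p q k m = concatMap (Xblocks o p q k m) (splits k)

Xcoef-true≡ : ∀ B e → Xcoef true B e ≡ Xcoef′ -1ℤ 0 B e
Xcoef-true≡ (b ∷ bs) (e ∷ es) = cong (λ z → binomℤ z e ℚ.* Xcoef false bs es) (ring (+ wt b) (+ dep b) (+ e))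
  where ring : ∀ W D E → W ℤ.- D ℤ.+ E ℤ.+ + 1 ℤ.- + 2 ≡ ((W ℤ.- D) ℤ.+ + 0) ℤ.+ E ℤ.+ -[1+ 0 ]
        ring = ZS.solve-∀
Xcoef-true≡ [] _ = refl
Xcoef-true≡ (b ∷ bs) [] = refl

Xcoef-false≡ : ∀ B e → Xcoef false B e ≡ Xcoef′ -2ℤ 0 B e
Xcoef-false≡ (b ∷ bs) (e ∷ es) = cong (λ z → binomℤ z e ℚ.* Xcoef false bs es) (ring (+ wt b) (+ dep b) (+ e))
  where ring : ∀ W D E → W ℤ.- D ℤ.+ E ℤ.+ + 0 ℤ.- + 2 ≡ ((W ℤ.- D) ℤ.+ + 0) ℤ.+ E ℤ.+ -[1+ 1 ]
        ring = ZS.solve-∀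
Xcoef-false≡ [] _ = refl
Xcoef-false≡ (b ∷ bs) [] = refl

Xword≡ : ∀ B e → Xword B e ≡ Xword′ 0 B e
Xword≡ (b ∷ bs) (e ∷ es) = cong (λ z → 𝕪 ∷ replicate (z ∸ 1) 𝕩 ++ Xword bs es) (cong (_+ e) (sym (NP.+-identityʳ (wt b))))
Xword≡ [] _ = refl
Xword≡ (b ∷ bs) [] = refl

X≡X′ : ∀ k m → X k m ≡ X′ -1ℤ 0 0 k m
X≡X′ k m = LP.concatMap-cong (λ B → LP.map-cong (λ e → cong₂ (λ c w → (c , dep k ∸ length B + m , w)) (Xcoef-true≡ B e) (Xword≡ B e)) (comps m (length B))) (splits k)

splits-length : ∀ k → All (λ B → length B ≤ length k) (splits k)
splits-length [] = z≤n ∷ []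
splits-length (k ∷ ks) = go (splits ks) (splits-length ks)
  where
  go : ∀ L → All (λ B → length B ≤ length ks) L → All (λ B → length B ≤ suc (length ks)) (concatMap (addFront k) L)
  go [] [] = []
  go ([] ∷ L) (_ ∷ ps) = s≤s z≤n ∷ go L ps
  go ((b ∷ bs) ∷ L) (l ∷ ps) = s≤s l ∷ NP.m≤n⇒m≤1+n l ∷ go L ps

data NonEmpty : List Index → Set where
  nonEmpty : ∀ b bs → NonEmpty (b ∷ bs)

splits-nonEmpty : ∀ k ks → All NonEmpty (splits (k ∷ ks))
splits-nonEmpty k ks = go (splits ks)
  where
  go : ∀ L → All NonEmpty (concatMap (addFront k) L)
  go [] = []
  go ([] ∷ L) = nonEmpty _ _ ∷ go L
  go ((b ∷ bs) ∷ L) = nonEmpty _ _ ∷ nonEmpty _ _ ∷ go L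

sumBelow-lmul-y𝕩^ : ∀ d n F → sumBelow n (λ i → lmul 𝕪 (lmulWord (𝕩^ d) (F i))) ≡ lmul 𝕪 (lmul𝕩^ d (sumBelow n F))
sumBelow-lmul-y𝕩^ d n F = begin
  sumBelow n (λ i → lmul 𝕪 (lmulWord (𝕩^ d) (F i)))  ≡⟨ map-sumBelow (lmulTerm 𝕪) n (lmulWord (𝕩^ d) ∘ F) ⟨
  lmul 𝕪 (sumBelow n (lmulWord (𝕩^ d) ∘ F))         ≡⟨ cong (lmul 𝕪) (map-sumBelow (lmulWordTerm (𝕩^ d)) n F) ⟨
  lmul 𝕪 (lmulWord (𝕩^ d) (sumBelow n F))            ≡⟨ cong (lmul 𝕪) (lmulWord-𝕩^ d (sumBelow n F)) ⟩
  lmul 𝕪 (lmul𝕩^ d (sumBelow n F))                   ∎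
  where open ≡-Reasoning

Xclosed : ℤ → ℕ → ℕ → Index → ℕ → Poly
Xclosed o p d [] m = []
Xclosed o p d (k1 ∷ k') m = lmul 𝕪 (lmul𝕩^ d (mulBinomial o (p + k1 ∸ 1) (substitute (idxWord k')) m))

+-suc-∸1 : ∀ p k → p + suc k ∸ 1 ≡ p + k
+-suc-∸1 p k = cong (_∸ 1) (NP.+-suc p k)

firstBlock-binomTop : ∀ k p o i → ((+ (suc k + 0) ℤ.- + 1) ℤ.+ + p) ℤ.+ + i ℤ.+ o ≡ + (p + suc k ∸ 1) ℤ.+ + i ℤ.+ o
firstBlock-binomTop k p o i = trans (cong (λ z → ((+ z ℤ.- + 1) ℤ.+ + p) ℤ.+ + i ℤ.+ o) (NP.+-identityʳ (suc k)))
    (trans (cong (λ z → ((z ℤ.- + 1) ℤ.+ + p) ℤ.+ + i ℤ.+ o) (ZP.pos-+ 1 k))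
    (trans (ring (+ k) (+ p) (+ i) o) (cong (λ z → z ℤ.+ + i ℤ.+ o) (trans (sym (ZP.pos-+ p k)) (cong +_ (sym (+-suc-∸1 p k)))))))
    where ring : ∀ K Q I O → ((+ 1 ℤ.+ K ℤ.- + 1) ℤ.+ Q) ℤ.+ I ℤ.+ O ≡ (Q ℤ.+ K) ℤ.+ I ℤ.+ O
          ring = ZS.solve-∀

firstBlock-xExponent : ∀ k p d i → suc k + 0 + (p + d) + i ∸ 1 ≡ d + ((p + suc k ∸ 1) + i)
firstBlock-xExponent k p d i = trans (ring k p d i) (cong (λ z → d + (z + i)) (sym (+-suc-∸1 p k)))
    where ring : ∀ k p d i → k + 0 + (p + d) + i ≡ d + (p + k + i)
          ring = NS.solve-∀

X′≋Xclosed-singleton : ∀ k1 → 1 ≤ k1 → ∀ o p d m → X′ o p (p + d) (k1 ∷ []) m ≋ Xclosed o p d (k1 ∷ []) m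
X′≋Xclosed-singleton (suc k) _ o p d m = begin
  map f (comps m 1) ++ [] ≈⟨ ++-identityʳ≋ (map f (comps m 1)) ⟩
  map f (comps m 1) ≡⟨ cong (map f) (comps-suc m 0) ⟩
  map f (concatMap (λ i → map (i ∷_) (comps (m ∸ i) 0)) (upTo (suc m))) ≡⟨ LP.map-concatMap f _ (upTo (suc m)) ⟩
  concatMap (λ i → map f (map (i ∷_) (comps (m ∸ i) 0))) (upTo (suc m)) ≡⟨ concatMap-upTo _ (suc m) ⟩
  sumBelow (suc m) (λ i → map f (map (i ∷_) (comps (m ∸ i) 0))) ≡⟨ sumBelow-cong (suc m) termsAt ⟩
  sumBelow (suc m) (λ i → lmul 𝕪 (lmulWord (𝕩^ d) (binomPoly o P i (substitute [] (m ∸ i)))))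
    ≡⟨ sumBelow-lmul-y𝕩^ d (suc m) (λ i → binomPoly o P i (substitute [] (m ∸ i))) ⟩
  lmul 𝕪 (lmul𝕩^ d (mulBinomial o P (substitute []) m)) ∎
  where
  open ≋-Reasoning
  P = p + suc k ∸ 1
  f = Xterm o p (p + d) (suc k ∷ []) m ((suc k ∷ []) ∷ [])
  termsAt : ∀ i → i < suc m → map f (map (i ∷_) (comps (m ∸ i) 0)) ≡ lmul 𝕪 (lmulWord (𝕩^ d) (binomPoly o P i (substitute [] (m ∸ i))))
  termsAt i i<sm with m ∸ i in eq
  ... | suc _ = refl
  ... | zero = cong (_∷ []) (term-cong
        (trans (QP.*-identityʳ _) (sym (trans (QP.*-identityʳ _) (cong (λ z → binomℤ z i) (sym (firstBlock-binomTop k p o i))))))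
        (trans (sym i≡m) (sym (NP.+-identityʳ i)))
        (cong (𝕪 ∷_) (trans (cong (λ z → replicate z 𝕩 ++ []) (firstBlock-xExponent k p d i)) (trans (cong (_++ []) (sym (𝕩^-+ d (P + i)))) (LP.++-assoc (𝕩^ d) (𝕩^ (P + i)) [])))))
    where
    i≡m : i ≡ m
    i≡m = NP.≤-antisym (NP.≤-pred i<sm) (NP.m∸n≡0⇒m≤n eq)

Xblocks-cut : ∀ k o p d k' m b bs → Xblocks o p (p + d) (suc k ∷ k') m ((suc k ∷ []) ∷ b ∷ bs) ≡
  sumBelow (suc m) (λ i → lmul 𝕪 (lmulWord (𝕩^ d) (binomPoly o (p + suc k ∸ 1) i (Xblocks -2ℤ 0 0 k' (m ∸ i) (b ∷ bs)))))
Xblocks-cut k o p d k' m b bs = begin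
  map f (comps m (suc l)) ≡⟨ cong (map f) (comps-suc m l) ⟩
  map f (concatMap (λ i → map (i ∷_) (comps (m ∸ i) l)) (upTo (suc m))) ≡⟨ LP.map-concatMap f _ (upTo (suc m)) ⟩
  concatMap (λ i → map f (map (i ∷_) (comps (m ∸ i) l))) (upTo (suc m)) ≡⟨ concatMap-upTo _ (suc m) ⟩
  sumBelow (suc m) (λ i → map f (map (i ∷_) (comps (m ∸ i) l))) ≡⟨ sumBelow-cong (suc m) termsAt ⟩
  sumBelow (suc m) (λ i → lmul 𝕪 (lmulWord (𝕩^ d) (binomPoly o P i (Xblocks -2ℤ 0 0 k' (m ∸ i) B)))) ∎
  where
  open ≡-Reasoning
  B = b ∷ bs
  l = length B
  P = p + suc k ∸ 1
  f = Xterm o p (p + d) (suc k ∷ k') m ((suc k ∷ []) ∷ B)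
  cutTerm : ℕ → List ℕ → Term
  cutTerm i = lmulTerm 𝕪 ∘ lmulWordTerm (𝕩^ d) ∘ binomTerm (binomCoeff o P i) i (P + i) ∘ Xterm -2ℤ 0 0 k' (m ∸ i) B
  termsAt : ∀ i → i < suc m → map f (map (i ∷_) (comps (m ∸ i) l)) ≡ lmul 𝕪 (lmulWord (𝕩^ d) (binomPoly o P i (Xblocks -2ℤ 0 0 k' (m ∸ i) B)))
  termsAt i i<sm = trans (map-map f (i ∷_) _) (trans (LP.map-cong termwise (comps (m ∸ i) l))
    (sym (trans (cong (lmul 𝕪 ∘ lmulWord (𝕩^ d)) (map-map (binomTerm (binomCoeff o P i) i (P + i)) (Xterm -2ℤ 0 0 k' (m ∸ i) B) _))
      (trans (cong (lmul 𝕪) (map-map (lmulWordTerm (𝕩^ d)) _ _)) (map-map (lmulTerm 𝕪) _ _)))))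
    where
    tExponent : ∀ D → D + m ≡ i + (D + (m ∸ i))
    tExponent D = trans (cong (λ z → D + z) (sym (NP.m+[n∸m]≡n (NP.≤-pred i<sm)))) (ring′ D i (m ∸ i))
      where ring′ : ∀ D i j → D + (i + j) ≡ i + (D + j)
            ring′ = NS.solve-∀
    termwise : ∀ e' → f (i ∷ e') ≡ cutTerm i e'
    termwise e' = term-cong
      (cong₂ ℚ._*_ (cong (λ z → binomℤ z i) (firstBlock-binomTop k p o i)) (Xcoef-false≡ B e'))
      (tExponent (length k' ∸ l))
      (cong (𝕪 ∷_) (trans (cong₂ (λ z w → replicate z 𝕩 ++ w) (firstBlock-xExponent k p d i) (Xword≡ B e'))
        (trans (cong (_++ Xword′ 0 B e') (sym (𝕩^-+ d (P + i)))) (LP.++-assoc (𝕩^ d) (𝕩^ (P + i)) (Xword′ 0 B e')))))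

Xblocks-join : ∀ k o p q k' m b bs → length (b ∷ bs) ≤ length k' →
  Xblocks o p q (suc k ∷ k') m ((suc k ∷ b) ∷ bs) ≡ tmul (Xblocks o (p + suc k ∸ 1) (q + suc k) k' m (b ∷ bs))
Xblocks-join k o p q k' m b bs l≤ = trans (LP.map-cong termwise (comps m (length (b ∷ bs)))) (sym (map-map tmulTerm _ _))
  where
  P = p + suc k ∸ 1
  tExponent : suc (length k') ∸ length (b ∷ bs) + m ≡ suc (length k' ∸ length (b ∷ bs) + m)
  tExponent = cong (_+ m) (NP.+-∸-assoc 1 l≤)
  binomTop : ∀ e1 → ((+ wt (suc k ∷ b) ℤ.- + dep (suc k ∷ b)) ℤ.+ + p) ℤ.+ + e1 ℤ.+ o ≡ ((+ wt b ℤ.- + dep b) ℤ.+ + P) ℤ.+ + e1 ℤ.+ o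
  binomTop e1 = trans (cong₂ (λ a c → ((a ℤ.- c) ℤ.+ + p) ℤ.+ + e1 ℤ.+ o) (trans (ZP.pos-+ (suc k) (wt b)) (cong (ℤ._+ + wt b) (ZP.pos-+ 1 k))) (ZP.pos-+ 1 (dep b)))
    (trans (ring (+ k) (+ wt b) (+ dep b) (+ p) (+ e1) o) (cong (λ z → ((+ wt b ℤ.- + dep b) ℤ.+ z) ℤ.+ + e1 ℤ.+ o) (trans (sym (ZP.pos-+ p k)) (cong +_ (sym (+-suc-∸1 p k))))))
    where ring : ∀ K W D Q E O → (((+ 1 ℤ.+ K) ℤ.+ W ℤ.- (+ 1 ℤ.+ D)) ℤ.+ Q) ℤ.+ E ℤ.+ O ≡ ((W ℤ.- D) ℤ.+ (Q ℤ.+ K)) ℤ.+ E ℤ.+ O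
          ring = ZS.solve-∀
  xExponent : ∀ e1 → suc k + wt b + q + e1 ∸ 1 ≡ wt b + (q + suc k) + e1 ∸ 1
  xExponent e1 = cong (_∸ 1) (ring (suc k) (wt b) q e1)
    where ring : ∀ K W q e → K + W + q + e ≡ W + (q + K) + e
          ring = NS.solve-∀
  termwise : ∀ e → Xterm o p q (suc k ∷ k') m ((suc k ∷ b) ∷ bs) e ≡ tmulTerm (Xterm o P (q + suc k) k' m (b ∷ bs) e)
  termwise [] = cong (λ z → (1ℚ , z , [])) tExponent
  termwise (e1 ∷ es) = term-cong (cong (λ z → binomℤ z e1 ℚ.* Xcoef false bs es) (binomTop e1)) tExponent
    (cong (λ z → 𝕪 ∷ replicate z 𝕩 ++ Xword bs es) (xExponent e1))

X′-cons : ∀ k o p d k2 k'' m →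
  X′ o p (p + d) (suc k ∷ k2 ∷ k'') m ≋
  lmul 𝕪 (lmul𝕩^ d (mulBinomial o (p + suc k ∸ 1) (X′ -2ℤ 0 0 (k2 ∷ k'')) m)) ++ tmul (X′ o (p + suc k ∸ 1) (p + d + suc k) (k2 ∷ k'') m)
X′-cons k o p d k2 k'' m = begin
  concatMap (Xblocks o p q (suc k ∷ k') m) (concatMap (addFront (suc k)) (splits k'))
    ≡⟨ concatMap-concatMap (Xblocks o p q (suc k ∷ k') m) (addFront (suc k)) (splits k') ⟩
  concatMap (concatMap (Xblocks o p q (suc k ∷ k') m) ∘ addFront (suc k)) (splits k')
    ≈⟨ concatMap-cong≋-All (All.zipWith (λ (cons , short) → blockSplit cons short) (splits-nonEmpty k2 k'' , splits-length k')) ⟩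
  concatMap (λ B → cutAtHead B ++ joinHead B) (splits k') ≈⟨ concatMap-split cutAtHead joinHead (splits k') ⟩
  concatMap cutAtHead (splits k') ++ concatMap joinHead (splits k')
    ≈⟨ ++-cong (≋-sym (sumBelow-concatMap (suc m) (λ i B → lmul 𝕪 (lmulWord (𝕩^ d) (binomPoly o P i (Xblocks -2ℤ 0 0 k' (m ∸ i) B))))  (splits k')))
               (≡⇒≋ (sym (LP.map-concatMap tmulTerm (Xblocks o P (q + suc k) k' m) (splits k')))) ⟩
  sumBelow (suc m) (λ i → concatMap (λ B → lmul 𝕪 (lmulWord (𝕩^ d) (binomPoly o P i (Xblocks -2ℤ 0 0 k' (m ∸ i) B)))) (splits k')) ++ tmul (X′ o P (q + suc k) k' m)
    ≡⟨ cong (_++ tmul (X′ o P (q + suc k) k' m)) (trans (sumBelow-cong (suc m) (λ i _ → inner i))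
         (sumBelow-lmul-y𝕩^ d (suc m) (λ i → binomPoly o P i (X′ -2ℤ 0 0 k' (m ∸ i))))) ⟩
  lmul 𝕪 (lmul𝕩^ d (mulBinomial o P (X′ -2ℤ 0 0 k') m)) ++ tmul (X′ o P (q + suc k) k' m) ∎
  where
  open ≋-Reasoning
  k' = k2 ∷ k''
  q = p + d
  P = p + suc k ∸ 1
  cutAtHead : List Index → Poly
  cutAtHead B = sumBelow (suc m) (λ i → lmul 𝕪 (lmulWord (𝕩^ d) (binomPoly o P i (Xblocks -2ℤ 0 0 k' (m ∸ i) B))))
  joinHead : List Index → Poly
  joinHead B = tmul (Xblocks o P (q + suc k) k' m B)
  blockSplit : ∀ {B} → NonEmpty B → length B ≤ length k' → concatMap (Xblocks o p q (suc k ∷ k') m) (addFront (suc k) B) ≋ cutAtHead B ++ joinHead B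
  blockSplit (nonEmpty b bs) l≤ = ++-cong (≡⇒≋ (Xblocks-cut k o p d k' m b bs))
    (≋-trans (++-identityʳ≋ (Xblocks o p q (suc k ∷ k') m ((suc k ∷ b) ∷ bs))) (≡⇒≋ (Xblocks-join k o p q k' m b bs l≤)))
  inner : ∀ i → concatMap (λ B → lmul 𝕪 (lmulWord (𝕩^ d) (binomPoly o P i (Xblocks -2ℤ 0 0 k' (m ∸ i) B)))) (splits k')
              ≡ lmul 𝕪 (lmulWord (𝕩^ d) (binomPoly o P i (X′ -2ℤ 0 0 k' (m ∸ i))))
  inner i = sym (trans (cong (lmul 𝕪 ∘ lmulWord (𝕩^ d)) (LP.map-concatMap (binomTerm (binomCoeff o P i) i (P + i)) (Xblocks -2ℤ 0 0 k' (m ∸ i)) (splits k')))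
    (trans (cong (lmul 𝕪) (LP.map-concatMap (lmulWordTerm (𝕩^ d)) (binomPoly o P i ∘ Xblocks -2ℤ 0 0 k' (m ∸ i)) (splits k')))
    (LP.map-concatMap (lmulTerm 𝕪) (lmulWord (𝕩^ d) ∘ binomPoly o P i ∘ Xblocks -2ℤ 0 0 k' (m ∸ i)) (splits k'))))

substitute-y : ∀ k2 k'' i → substitute (idxWord (k2 ∷ k'')) i ≋ Xclosed -2ℤ 0 0 (k2 ∷ k'') i ++ tmul (lmul 𝕩 (substitute (𝕩^ (k2 ∸ 1) ++ idxWord k'') i))
substitute-y k2 k'' i = begin
  lmul 𝕪 (S i) ++ (tmul (lmul 𝕩 (S i)) ++ neg (tmul (lmul 𝕪 (lmul 𝕩 (mulU S i)))))
    ≈⟨ ≋-trans (++-cong (≋-refl {lmul 𝕪 (S i)}) (++-comm≋ (tmul (lmul 𝕩 (S i))) _)) (≋-sym (++-assoc≋ (lmul 𝕪 (S i)) _ _)) ⟩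
  (lmul 𝕪 (S i) ++ neg (tmul (lmul 𝕪 (lmul 𝕩 (mulU S i))))) ++ tmul (lmul 𝕩 (S i))
    ≡⟨ cong (_++ tmul (lmul 𝕩 (S i))) (trans (cong (lmul 𝕪 (S i) ++_) neg-lmul-y) (sym (LP.map-++ (lmulTerm 𝕪) (S i) _))) ⟩
  lmul 𝕪 (S i ++ neg (tmul (lmul 𝕩 (mulU S i)))) ++ tmul (lmul 𝕩 (S i))
    ≈⟨ ++-cong (lmul-cong 𝕪 (≋-trans (≋-sym (mulBinomial-1-xtu S i)) (mulBinomial-substitute-𝕩^ -2ℤ 0 (k2 ∸ 1) (idxWord k'') i)))
               (≋-refl {tmul (lmul 𝕩 (S i))}) ⟩
  Xclosed -2ℤ 0 0 (k2 ∷ k'') i ++ tmul (lmul 𝕩 (S i)) ∎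
  where
  open ≋-Reasoning
  S = substitute (𝕩^ (k2 ∸ 1) ++ idxWord k'')
  Z = lmul 𝕩 (mulU S i)
  neg-lmul-y : neg (tmul (lmul 𝕪 Z)) ≡ lmul 𝕪 (neg (tmul Z))
  neg-lmul-y = trans (cong neg (map-map tmulTerm (lmulTerm 𝕪) Z)) (trans (map-map negTerm _ Z)
    (sym (trans (cong (lmul 𝕪) (map-map negTerm tmulTerm Z)) (map-map (lmulTerm 𝕪) _ Z))))

X′≋Xclosed : ∀ k' k1 → All (1 ≤_) (k1 ∷ k') → ∀ o p d m → X′ o p (p + d) (k1 ∷ k') m ≋ Xclosed o p d (k1 ∷ k') m
X′≋Xclosed [] k1 (h ∷ _) o p d m = X′≋Xclosed-singleton k1 h o p d m
X′≋Xclosed (k2 ∷ k'') (suc k) (_ ∷ h2 ∷ hs) o p d m = begin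
  X′ o p (p + d) (suc k ∷ k') m ≈⟨ X′-cons k o p d k2 k'' m ⟩
  lmul 𝕪 (lmul𝕩^ d (mulBinomial o P (X′ -2ℤ 0 0 k') m)) ++ tmul (X′ o P (p + d + suc k) k' m)
    ≈⟨ ++-cong (lmul-cong 𝕪 (lmul𝕩^-cong d (mulBinomial-cong≋ o P (X′≋Xclosed k'' k2 (h2 ∷ hs) -2ℤ 0 0) m)))
               (tmul-cong (≋-trans (≡⇒≋ (cong (λ z → X′ o P z k' m) offset)) (X′≋Xclosed k'' k2 (h2 ∷ hs) o P (suc d) m))) ⟩
  lmul 𝕪 (lmul𝕩^ d (mulBinomial o P (Xclosed -2ℤ 0 0 k') m)) ++ tmul (Xclosed o P (suc d) k' m)
    ≈⟨ unfoldHead ⟨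
  Xclosed o p d (suc k ∷ k') m ∎
  where
  open ≋-Reasoning
  k' = k2 ∷ k''
  P = p + suc k ∸ 1
  S = substitute (𝕩^ (k2 ∸ 1) ++ idxWord k'')
  offset : p + d + suc k ≡ P + suc d
  offset = trans (ring p d k) (cong (_+ suc d) (sym (+-suc-∸1 p k)))
    where ring : ∀ p d k → p + d + suc k ≡ p + k + suc d
          ring = NS.solve-∀
  T1 = mulBinomial o P (Xclosed -2ℤ 0 0 k') m
  Z = mulBinomial o (P + (k2 ∸ 1)) (substitute (idxWord k'')) m
  shiftedTail : lmul 𝕪 (lmul𝕩^ d (tmul (lmul 𝕩 Z))) ≡ tmul (Xclosed o P (suc d) k' m)
  shiftedTail = trans (cong (lmul 𝕪) (trans (lmul𝕩^-tmul d (lmul 𝕩 Z)) (cong tmul (trans (lmul𝕩^-+ d 1 Z) (cong (λ z → lmul𝕩^ z Z) (NP.+-comm d 1))))))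
    (trans (lmul-tmul 𝕪 _) (cong (λ z → tmul (lmul 𝕪 (lmul𝕩^ (suc d) (mulBinomial o z (substitute (idxWord k'')) m)))) (sym (NP.+-∸-assoc P h2))))
  unfoldHead : Xclosed o p d (suc k ∷ k') m ≋ lmul 𝕪 (lmul𝕩^ d T1) ++ tmul (Xclosed o P (suc d) k' m)
  unfoldHead = begin
    lmul 𝕪 (lmul𝕩^ d (mulBinomial o P (substitute (idxWord k')) m))
      ≈⟨ lmul-cong 𝕪 (lmul𝕩^-cong d (≋-trans (mulBinomial-cong≋ o P (substitute-y k2 k'') m) (mulBinomial-++ o P (Xclosed -2ℤ 0 0 k') (λ i → tmul (lmul 𝕩 (S i))) m))) ⟩
    lmul 𝕪 (lmul𝕩^ d (T1 ++ mulBinomial o P (λ i → tmul (lmul 𝕩 (S i))) m))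
      ≡⟨ cong (λ z → lmul 𝕪 (lmul𝕩^ d (T1 ++ z))) (trans (mulBinomial-tmul o P (λ i → lmul 𝕩 (S i)) m) (cong tmul (mulBinomial-lmul-x o P S m))) ⟩
    lmul 𝕪 (lmul𝕩^ d (T1 ++ tmul (lmul 𝕩 (mulBinomial o P S m))))
      ≈⟨ lmul-cong 𝕪 (lmul𝕩^-cong d (++-cong (≋-refl {T1}) (tmul-cong (lmul-cong 𝕩 (mulBinomial-substitute-𝕩^ o P (k2 ∸ 1) (idxWord k'') m))))) ⟩
    lmul 𝕪 (lmul𝕩^ d (T1 ++ tmul (lmul 𝕩 Z))) ≡⟨ trans (cong (lmul 𝕪) (lmul𝕩^-++ d T1 _)) (LP.map-++ (lmulTerm 𝕪) (lmul𝕩^ d T1) _) ⟩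
    lmul 𝕪 (lmul𝕩^ d T1) ++ lmul 𝕪 (lmul𝕩^ d (tmul (lmul 𝕩 Z))) ≡⟨ cong (lmul 𝕪 (lmul𝕩^ d T1) ++_) shiftedTail ⟩
    lmul 𝕪 (lmul𝕩^ d T1) ++ tmul (Xclosed o P (suc d) k' m) ∎

X≋substitute : ∀ k₁ k′ → All (1 ≤_) (k₁ ∷ k′) → ∀ m → X (k₁ ∷ k′) m ≋ lmul 𝕪 (substitute (𝕩^ (k₁ ∸ 1) ++ idxWord k′) m)
X≋substitute k₁ k′ pos m = begin
  X (k₁ ∷ k′) m                                     ≡⟨ X≡X′ (k₁ ∷ k′) m ⟩
  X′ -1ℤ 0 0 (k₁ ∷ k′) m                             ≈⟨ X′≋Xclosed k′ k₁ pos -1ℤ 0 0 m ⟩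
  lmul 𝕪 (mulBinomial -1ℤ (k₁ ∸ 1) S m)              ≈⟨ lmul-cong 𝕪 (mulBinomial-mulX′^ -1ℤ 0 (k₁ ∸ 1) S m) ⟨
  lmul 𝕪 (mulBinomial -1ℤ 0 (mulX′^ (k₁ ∸ 1) S) m)   ≈⟨ lmul-cong 𝕪 (mulBinomial-one (mulX′^ (k₁ ∸ 1) S) m) ⟩
  lmul 𝕪 (mulX′^ (k₁ ∸ 1) S m)                      ≈⟨ lmul-cong 𝕪 (substitute-𝕩^ (k₁ ∸ 1) (idxWord k′) m) ⟨
  lmul 𝕪 (substitute (𝕩^ (k₁ ∸ 1) ++ idxWord k′) m) ∎
  where
  open ≋-Reasoning
  S = substitute (idxWord k′)

proposition3p4 : (k : List ℕ) → All (1 ≤_) k → Admissible k →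
    (m n : ℕ) (w : Word) → coeff (LHS k m) n w ≡ coeff (τ (σ (τ (X k))) m) n w
proposition3p4 [] _ ([] , _ , () , _)
proposition3p4 [] _ (_ ∷ _ , _ , () , _)
proposition3p4 k@(k₁ ∷ k′) pos adm m = ≋e (begin
  LHS k m                                        ≈⟨ LHS≋Φτστ k₁ k′ pos adm m ⟩
  lmul 𝕪 (Φτστ m v)                              ≈⟨ lmul-cong 𝕪 (Φτστ≋τστ-substitute v m) ⟩
  lmul 𝕪 (τστ (substitute v) m)                  ≡⟨ τστ-lmul-y (substitute v) m ⟨
  τστ (lmul 𝕪 ∘ substitute v) m                  ≈⟨ τστ-cong≋ (X≋substitute k₁ k′ pos) m ⟨
  τστ (X k) m                                    ≡⟨ τ-σ-τ≡τστ (X k) m ⟨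
  τ (σ (τ (X k))) m                              ∎)
  where
  open ≋-Reasoning
  v = 𝕩^ (k₁ ∸ 1) ++ idxWord k′
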